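{- Let $n,k$ be positive integers and let $\mathcal{P}(n,1,1)$ be the set of lattice paths with steps $U=(1,1)$ and $D=(1,-1)$ from $(0,0)$ to $(2n+1,1)$. Then: (1) for each $j=0,1,\dots,k-1$, the number of paths in $\mathcal{P}(n,1,1)$ with $k-1$ peaks that start with a down step and end with an up step and have exactly $j$ peaks on or below the $x$-axis is $\frac{1}{k}\binom{n}{k-1}\binom{n-1}{k-1}$; (2) for each $j=0,1,\dots,k-1$, the number of paths in $\mathcal{P}(n,1,1)$ with $k-1$ valleys that start with an up step and end with a down step and have exactly $j$ valleys on or below the $x$-axis is $\frac{1}{k}\binom{n}{k-1}\binom{n-1}{k-1}$; (3) for each $j=0,1,\dots,n-k$, the number of paths in $\mathcal{P}(n,1,1)$ with $n-k$ double rises that start with an up step and end with an up step and have exactly $j$ double rises on or below the $x$-axis is $\frac{1}{n-k+1}\binom{n}{k}\binom{n-1}{k-1}$; (4) if $k<n$, then for each $j=0,1,\dots,n-k-1$, the number of paths in $\mathcal{P}(n,1,1)$ with $n-k-1$ double falls that start with a down step and end with a down step and have exactly $j$ double falls on or below the $x$-axis is $\frac{1}{n-k}\binom{n}{k-1}\binom{n-1}{k}$; (5) for each $j=1,2,\dots,n+1$, the number of paths in $\mathcal{P}(n,1,1)$ with $k$ peaks that start with an up step and have exactly $j$ up steps starting on or below the $x$-axis is $\frac{1}{n+1}\binom{n+1}{k}\binom{n-1}{k-1}$; (6) for each $j=1,2,\dots,n$, the number of paths in $\mathcal{P}(n,1,1)$ with $k$ valleys that start with a down step and have exactly $j$ down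 steps starting on or below the $x$-axis is $\frac{1}{n}\binom{n}{k}\binom{n}{k-1}$.
   Context: Encode a path as a word in $U,D$. A peak is an occurrence of $UD$, a valley an occurrence of $DU$, a double rise an occurrence of $UU$, a double fall an occurrence of $DD$. Such an occurrence lies on or below the $x$-axis if the vertex between its two consecutive steps has $y$-coordinate $\le 0$. A step starts on or below the $x$-axis if its initial vertex has $y$-coordinate $\le 0$. -}

module Defs where

open import Data.Bool using (Bool; true; false; _∧_; if_then_else_)
open import Data.Nat using (ℕ; zero; suc; _+_; _*_; _≡ᵇ_)
open import Data.Integer as ℤ using (ℤ; +_; _≤ᵇ_)
open import Data.List using (List; []; _∷_; length; filterᵇ)

-- Steps U = (1,1) and D = (1,-1); a path is a word in U, D.
data Step : Set where
  U D : Step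

_==_ : Step → Step → Bool
U == U = true
D == D = true
_ == _ = false

δ : Step → ℤ
δ U = + 1
δ D = ℤ.- (+ 1)

words : ℕ → List (List Step)
words zero = [] ∷ []
words (suc m) = Data.List.map (U ∷_) (words m) Data.List.++ Data.List.map (D ∷_) (words m)

heightFrom : ℤ → List Step → ℤ
heightFrom h [] = h
heightFrom h (x ∷ w) = heightFrom (h ℤ.+ δ x) w

inP : ℕ → List Step → Bool
inP n w = (length w ≡ᵇ (2 * n + 1)) ∧ (((heightFrom (+ 0) w) ℤ.≤ᵇ (+ 1)) ∧ ((+ 1) ℤ.≤ᵇ heightFrom (+ 0) w))

occFrom : Step → Step → ℤ → List Step → ℕ
occFrom a b h [] = 0
occFrom a b h (x ∷ []) = 0
occFrom a b h (x ∷ y ∷ w) =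
  (if (x == a) ∧ (y == b) then 1 else 0) + occFrom a b (h ℤ.+ δ x) (y ∷ w)

-- occurrences of a b whose middle vertex has y-coordinate ≤ 0
occBelowFrom : Step → Step → ℤ → List Step → ℕ
occBelowFrom a b h [] = 0
occBelowFrom a b h (x ∷ []) = 0
occBelowFrom a b h (x ∷ y ∷ w) =
  (if (x == a) ∧ (y == b) ∧ ((h ℤ.+ δ x) ℤ.≤ᵇ (+ 0)) then 1 else 0)
    + occBelowFrom a b (h ℤ.+ δ x) (y ∷ w)

occ : Step → Step → List Step → ℕ
occ a b = occFrom a b (+ 0)

occBelow : Step → Step → List Step → ℕ
occBelow a b = occBelowFrom a b (+ 0)

stepsBelowFrom : Step → ℤ → List Step → ℕ
stepsBelowFrom a h [] = 0
stepsBelowFrom a h (x ∷ w) =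
  (if (x == a) ∧ (h ℤ.≤ᵇ (+ 0)) then 1 else 0) + stepsBelowFrom a (h ℤ.+ δ x) w

stepsBelow : Step → List Step → ℕ
stepsBelow a = stepsBelowFrom a (+ 0)

startsWith : Step → List Step → Bool
startsWith s [] = false
startsWith s (x ∷ _) = x == s

endsWith : Step → List Step → Bool
endsWith s [] = false
endsWith s (x ∷ []) = x == s
endsWith s (_ ∷ y ∷ w) = endsWith s (y ∷ w)

countP : ℕ → (List Step → Bool) → ℕ
countP n p = length (filterᵇ (λ w → inP n w ∧ p w) (words (2 * n + 1)))

-- Read a path of P(n,1,1) cyclically.  For each of the statistics, the relevant occurrences
-- (peaks, valleys, double rises, double falls, resp. the vertices preceding an up or down step),
-- together with the seam between the last and the first step, are the m+1 places where the path
-- may be cut and re-glued; the conditions on the first and last step make the seam such a place.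
-- Order these places by height, breaking ties from the right.  Because the total height is 1,
-- after cutting at the place c exactly the places below c in this order end up on or below the
-- x-axis, so among the m+1 rotations the statistic takes each value 0, ..., m exactly once.
-- Rotating to the cut with a prescribed value is therefore a bijection between the classes of
-- the statistic, which is uniformly distributed.  The total number of paths is then counted by
-- their runs: given the first and last step, a path with r up-runs is a pair of compositions of
-- its up and down steps, and each statistic is determined by the number of up-runs.

module Submission where

open import Defs
open import Level using (Level)
open import Data.Bool using (Bool; true; false; _∧_; not; T; if_then_else_)
open import Data.Bool.Properties using (∧-assoc; ∧-zeroʳ; ∧-comm; ∧-commutativeMonoid)
open import Data.Empty using (⊥; ⊥-elim)
open import Data.Unit using (tt)
open import Data.Nat using (ℕ; zero; suc; _+_; _*_; _∸_; _≤_; _<_; z≤n; s≤s; _≡ᵇ_; _<ᵇ_; s≤s⁻¹)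
open import Data.Nat.Properties
open import Algebra.Properties.CommutativeSemigroup +-commutativeSemigroup
  using () renaming (interchange to +-interchange)
open import Algebra.Solver.CommutativeMonoid ∧-commutativeMonoid
  using (var; _⊕_) renaming (prove to ∧-prove)
import Data.Fin as Fin
open import Data.Vec using ([]; _∷_)
open import Data.Nat.Combinatorics using (_C_; nCk+nC[k+1]≡[n+1]C[k+1])
open import Data.Integer as ℤ using (ℤ; 0ℤ; 1ℤ)
import Data.Integer.Properties as ℤ
open import Data.Integer.Tactic.RingSolver using (solve-∀)
open import Data.Nat.Tactic.RingSolver using () renaming (solve-∀ to ℕ-solve-∀)
open import Data.List using (List; []; _∷_; length; _++_; map; filterᵇ; drop; take)
open import Data.List.Properties using (length-++; ++-identityʳ; length-map; length-removeAt′)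
open import Data.List.Membership.Propositional using (_∈_; _∉_; _─_)
open import Data.List.Membership.Propositional.Properties
  using (∈-++⁺ˡ; ∈-++⁺ʳ; ∈-++⁻; ∈-map⁺; ∈-map⁻; ∈-filter⁺; ∈-filter⁻)
open import Data.List.Relation.Unary.Any using (here; there)
open import Data.List.Relation.Unary.All using ([]) renaming (lookup to All-lookup)
open import Data.List.Relation.Unary.All.Properties using (¬Any⇒All¬)
open import Data.List.Relation.Unary.Unique.Propositional using (Unique; []; _∷_)
import Data.List.Relation.Unary.Unique.Propositional.Properties as Unique
open import Data.Product using (_×_; _,_; proj₁; proj₂; ∃-syntax)
open import Data.Sum using (_⊎_; inj₁; inj₂; [_,_])
open import Function using (_∘_)
open import Relation.Binary using (tri<; tri≈; tri>)
open import Relation.Binary.PropositionalEquality hiding ([_])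
open import Relation.Nullary using (¬_; Dec; yes; no)
open import Relation.Nullary.Decidable using (T?; isYes; toWitness; fromWitness)
open import Algebra.Properties.AbelianGroup ℤ.+-0-abelianGroup
  using (\\-leftDividesʳ) renaming (∙-cancelˡ to ℤ+-cancelˡ-≡; ∙-cancelʳ to ℤ+-cancelʳ-≡)

private variable
  a : Level
  A B : Set a

toℕ : Bool → ℕ
toℕ b = if b then 1 else 0

toℕ≤1 : ∀ b → toℕ b ≤ 1
toℕ≤1 true = s≤s z≤n
toℕ≤1 false = z≤n

toℕ-mono : ∀ {b c} → (T b → T c) → toℕ b ≤ toℕ c
toℕ-mono {true} {true} _ = ≤-refl
toℕ-mono {true} {false} f = ⊥-elim (f tt)
toℕ-mono {false} _ = z≤n

T-ext : ∀ {b c} → (T b → T c) → (T c → T b) → b ≡ c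
T-ext {true} {true} _ _ = refl
T-ext {true} {false} f _ = ⊥-elim (f tt)
T-ext {false} {true} _ g = ⊥-elim (g tt)
T-ext {false} {false} _ _ = refl

T⇒≡true : ∀ {b} → T b → b ≡ true
T⇒≡true {true} _ = refl

¬T⇒≡false : ∀ {b} → ¬ T b → b ≡ false
¬T⇒≡false {true} f = ⊥-elim (f tt)
¬T⇒≡false {false} _ = refl

T-∧⁻ : ∀ {b c} → T (b ∧ c) → T b × T c
T-∧⁻ {true} {true} _ = tt , tt

T-∧⁺ : ∀ {b c} → T b → T c → T (b ∧ c)
T-∧⁺ {true} {true} _ _ = tt

x∧[y∧[z∧false]]≡false : ∀ x y z → x ∧ (y ∧ (z ∧ false)) ≡ false
x∧[y∧[z∧false]]≡false x y z =
  trans (cong (λ t → x ∧ (y ∧ t)) (∧-zeroʳ z)) (trans (cong (x ∧_) (∧-zeroʳ y)) (∧-zeroʳ x))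

∧-shuffle : ∀ a b o s e → (a ∧ b) ∧ (o ∧ (s ∧ e)) ≡ s ∧ (e ∧ (a ∧ (b ∧ o)))
∧-shuffle a b o s e =
  ∧-prove 5 ((va ⊕ vb) ⊕ (vo ⊕ (vs ⊕ ve))) (vs ⊕ (ve ⊕ (va ⊕ (vb ⊕ vo)))) (a ∷ b ∷ o ∷ s ∷ e ∷ [])
  where
  va = var Fin.zero
  vb = var (Fin.suc Fin.zero)
  vo = var (Fin.suc (Fin.suc Fin.zero))
  vs = var (Fin.suc (Fin.suc (Fin.suc Fin.zero)))
  ve = var (Fin.suc (Fin.suc (Fin.suc (Fin.suc Fin.zero))))

∧-shuffle′ : ∀ a b o s → (a ∧ b) ∧ (o ∧ s) ≡ s ∧ (a ∧ (b ∧ o))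
∧-shuffle′ a b o s =
  ∧-prove 4 ((va ⊕ vb) ⊕ (vo ⊕ vs)) (vs ⊕ (va ⊕ (vb ⊕ vo))) (a ∷ b ∷ o ∷ s ∷ [])
  where
  va = var Fin.zero
  vb = var (Fin.suc Fin.zero)
  vo = var (Fin.suc (Fin.suc Fin.zero))
  vs = var (Fin.suc (Fin.suc (Fin.suc Fin.zero)))

≡ᵇ-cancel : ∀ {a b c d} → a + b ≡ c + d → (a ≡ᵇ c) ≡ (b ≡ᵇ d)
≡ᵇ-cancel {a} {b} {c} {d} eq = T-ext
  (λ a≡c → ≡⇒≡ᵇ b d (+-cancelˡ-≡ c b d (subst (λ x → x + b ≡ c + d) (≡ᵇ⇒≡ a c a≡c) eq)))
  (λ b≡d → ≡⇒≡ᵇ a c (+-cancelʳ-≡ d a c (subst (λ x → a + x ≡ c + d) (≡ᵇ⇒≡ b d b≡d) eq)))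

∧-reassoc : ∀ p q r {u u′} → (r ≡ true → u ≡ u′) → p ∧ (q ∧ (r ∧ u)) ≡ (p ∧ (q ∧ r)) ∧ u′
∧-reassoc true true true u≡u′ = u≡u′ refl
∧-reassoc true true false _ = refl
∧-reassoc true false r _ = refl
∧-reassoc false q r _ = refl

count : (A → Bool) → List A → ℕ
count P [] = 0
count P (x ∷ xs) = toℕ (P x) + count P xs

module _ (P : A → Bool) where

  length-filterᵇ : ∀ xs → length (filterᵇ P xs) ≡ count P xs
  length-filterᵇ [] = refl
  length-filterᵇ (x ∷ xs) with P x
  ... | true = cong suc (length-filterᵇ xs)
  ... | false = length-filterᵇ xs

  count-++ : ∀ xs ys → count P (xs ++ ys) ≡ count P xs + count P ys
  count-++ [] ys = refl
  count-++ (x ∷ xs) ys = trans (cong (toℕ (P x) +_) (count-++ xs ys)) (sym (+-assoc (toℕ (P x)) _ _))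

  count-map : (f : B → A) → ∀ xs → count P (map f xs) ≡ count (P ∘ f) xs
  count-map f [] = refl
  count-map f (x ∷ xs) = cong (toℕ (P (f x)) +_) (count-map f xs)

  count-≤-length : ∀ xs → count P xs ≤ length xs
  count-≤-length [] = z≤n
  count-≤-length (x ∷ xs) = +-mono-≤ (toℕ≤1 (P x)) (count-≤-length xs)

  count-<-length : ∀ {xs x} → x ∈ xs → ¬ T (P x) → count P xs < length xs
  count-<-length {x ∷ xs} (here refl) ¬Px rewrite ¬T⇒≡false ¬Px = s≤s (count-≤-length xs)
  count-<-length {y ∷ xs} (there x∈xs) ¬Px = +-mono-≤-< (toℕ≤1 (P y)) (count-<-length x∈xs ¬Px)

  count-all : ∀ xs → (∀ {x} → x ∈ xs → T (P x)) → count P xs ≡ length xs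
  count-all [] _ = refl
  count-all (x ∷ xs) all rewrite T⇒≡true (all (here refl)) = cong suc (count-all xs (all ∘ there))

  count-none : ∀ xs → (∀ {x} → x ∈ xs → P x ≡ false) → count P xs ≡ 0
  count-none [] _ = refl
  count-none (x ∷ xs) none rewrite none (here refl) = count-none xs (none ∘ there)

  count-pos⇒∃ : ∀ xs → 0 < count P xs → ∃[ x ] (x ∈ xs × T (P x))
  count-pos⇒∃ (x ∷ xs) pos with P x in eq
  ... | true = x , here refl , subst T (sym eq) tt
  ... | false with count-pos⇒∃ xs pos
  ...   | y , y∈xs , Py = y , there y∈xs , Py

  count≤1 : ∀ {xs} → Unique xs → (∀ {x y} → x ∈ xs → y ∈ xs → T (P x) → T (P y) → x ≡ y) → count P xs ≤ 1
  count≤1 [] _ = z≤n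
  count≤1 {x ∷ xs} (x∉ ∷ u) unique with P x in eq
  ... | false = count≤1 u (λ x∈ y∈ → unique (there x∈) (there y∈))
  ... | true = s≤s (≤-reflexive (count-none xs λ {y} y∈ → ¬T⇒≡false λ Py →
                 All-lookup x∉ y∈ (unique (here refl) (there y∈) (subst T (sym eq) tt) Py)))

module _ (P Q : A → Bool) where

  count-cong : ∀ xs → (∀ {x} → x ∈ xs → P x ≡ Q x) → count P xs ≡ count Q xs
  count-cong [] _ = refl
  count-cong (x ∷ xs) eq = cong₂ _+_ (cong toℕ (eq (here refl))) (count-cong xs (eq ∘ there))

  count-mono : ∀ xs → (∀ {x} → x ∈ xs → T (P x) → T (Q x)) → count P xs ≤ count Q xs
  count-mono [] _ = z≤n
  count-mono (x ∷ xs) P⇒Q = +-mono-≤ (toℕ-mono (P⇒Q (here refl))) (count-mono xs (P⇒Q ∘ there))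

  count-mono-< : ∀ {xs x} → (∀ {y} → y ∈ xs → T (P y) → T (Q y)) → x ∈ xs → T (Q x) → ¬ T (P x) →
                 count P xs < count Q xs
  count-mono-< {y ∷ xs} P⇒Q (here refl) Qx ¬Px
    rewrite ¬T⇒≡false ¬Px | T⇒≡true Qx = s≤s (count-mono xs (P⇒Q ∘ there))
  count-mono-< {y ∷ xs} P⇒Q (there x∈xs) Qx ¬Px =
    +-mono-≤-< (toℕ-mono (P⇒Q (here refl))) (count-mono-< (P⇒Q ∘ there) x∈xs Qx ¬Px)

count-split : (P Q R : A → Bool) → ∀ xs → (∀ {x} → x ∈ xs → toℕ (P x) ≡ toℕ (Q x) + toℕ (R x)) →
              count P xs ≡ count Q xs + count R xs
count-split P Q R [] _ = refl
count-split P Q R (x ∷ xs) eq =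
  trans (cong₂ _+_ (eq (here refl)) (count-split P Q R xs (eq ∘ there)))
        (+-interchange (toℕ (Q x)) (toℕ (R x)) (count Q xs) (count R xs))

∈-─⁺ : ∀ {x z : A} {ys} (x∈ys : x ∈ ys) → z ∈ ys → z ≢ x → z ∈ ys ─ x∈ys
∈-─⁺ (here refl) (here refl) z≢x = ⊥-elim (z≢x refl)
∈-─⁺ (here refl) (there z∈ys) _ = z∈ys
∈-─⁺ (there x∈ys) (here refl) _ = here refl
∈-─⁺ (there x∈ys) (there z∈ys) z≢x = there (∈-─⁺ x∈ys z∈ys z≢x)

length-≤-injection : (f : A → B) {xs : List A} {ys : List B} → Unique xs →
                     (∀ {x} → x ∈ xs → f x ∈ ys) →
                     (∀ {x y} → x ∈ xs → y ∈ xs → f x ≡ f y → x ≡ y) →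
                     length xs ≤ length ys
length-≤-injection f [] _ _ = z≤n
length-≤-injection f {x ∷ xs} {ys} (x∉xs ∷ u) into inj =
  subst (suc (length xs) ≤_) (sym (length-removeAt′ ys _))
        (s≤s (length-≤-injection f u into′ (λ y∈ z∈ → inj (there y∈) (there z∈))))
  where
  into′ : ∀ {z} → z ∈ xs → f z ∈ ys ─ into (here refl)
  into′ z∈xs = ∈-─⁺ (into (here refl)) (into (there z∈xs))
                    (λ fz≡fx → All-lookup x∉xs z∈xs (inj (here refl) (there z∈xs) (sym fz≡fx)))

count-≤-injection : (P Q : A → Bool) (f : A → A) {xs : List A} → Unique xs →
                    (∀ {x} → x ∈ xs → T (P x) → f x ∈ xs × T (Q (f x))) →
                    (∀ {x y} → x ∈ xs → y ∈ xs → T (P x) → T (P y) → f x ≡ f y → x ≡ y) →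
                    count P xs ≤ count Q xs
count-≤-injection P Q f {xs} u into inj =
  subst₂ _≤_ (length-filterᵇ P xs) (length-filterᵇ Q xs)
    (length-≤-injection f (Unique.filter⁺ (T? ∘ P) u) into′ inj′)
  where
  into′ : ∀ {x} → x ∈ filterᵇ P xs → f x ∈ filterᵇ Q xs
  into′ x∈ = let x∈xs , Px = ∈-filter⁻ (T? ∘ P) x∈ ; fx∈xs , Qfx = into x∈xs Px
             in ∈-filter⁺ (T? ∘ Q) fx∈xs Qfx
  inj′ : ∀ {x y} → x ∈ filterᵇ P xs → y ∈ filterᵇ P xs → f x ≡ f y → x ≡ y
  inj′ x∈ y∈ = let x∈xs , Px = ∈-filter⁻ (T? ∘ P) x∈ ; y∈xs , Py = ∈-filter⁻ (T? ∘ P) y∈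
               in inj x∈xs y∈xs Px Py

sumBelow : ℕ → (ℕ → ℕ) → ℕ
sumBelow zero g = 0
sumBelow (suc N) g = sumBelow N g + g N

module _ {g h : ℕ → ℕ} where

  sumBelow-cong : ∀ N → (∀ {j} → j < N → g j ≡ h j) → sumBelow N g ≡ sumBelow N h
  sumBelow-cong zero _ = refl
  sumBelow-cong (suc N) eq = cong₂ _+_ (sumBelow-cong N (eq ∘ m≤n⇒m≤1+n)) (eq ≤-refl)

  sumBelow-+ : ∀ N → sumBelow N (λ j → g j + h j) ≡ sumBelow N g + sumBelow N h
  sumBelow-+ zero = refl
  sumBelow-+ (suc N) = trans (cong (_+ (g N + h N)) (sumBelow-+ N)) (+-interchange (sumBelow N g) (sumBelow N h) (g N) (h N))

sumBelow-const : ∀ N c → sumBelow N (λ _ → c) ≡ N * c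
sumBelow-const zero c = refl
sumBelow-const (suc N) c = trans (cong (_+ c) (sumBelow-const N c)) (+-comm (N * c) c)

sumBelow-zero : ∀ N → sumBelow N (λ _ → 0) ≡ 0
sumBelow-zero N = trans (sumBelow-const N 0) (*-zeroʳ N)

sumBelow-indicator : ∀ N b v → sumBelow N (λ j → toℕ (b ∧ (v ≡ᵇ j))) ≡ toℕ (b ∧ (v <ᵇ N))
sumBelow-indicator N false v = sumBelow-zero N
sumBelow-indicator zero true v = refl
sumBelow-indicator (suc N) true v = trans (cong (_+ toℕ (v ≡ᵇ N)) (sumBelow-indicator N true v)) (step v N)
  where
  step : ∀ v N → toℕ (v <ᵇ N) + toℕ (v ≡ᵇ N) ≡ toℕ (v <ᵇ suc N)
  step zero zero = refl
  step zero (suc N) = refl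
  step (suc v) zero = refl
  step (suc v) (suc N) = step v N

sumBelow-count : ∀ N (P : A → Bool) (f : A → ℕ) xs →
  sumBelow N (λ j → count (λ x → P x ∧ (f x ≡ᵇ j)) xs) ≡ count (λ x → P x ∧ (f x <ᵇ N)) xs
sumBelow-count N P f [] = sumBelow-zero N
sumBelow-count N P f (x ∷ xs) =
  trans (sumBelow-+ N) (cong₂ _+_ (sumBelow-indicator N (P x) (f x)) (sumBelow-count N P f xs))

sumBelow-≤ : ∀ N {g} → (∀ {j} → j < N → g j ≤ 1) → sumBelow N g ≤ N
sumBelow-≤ zero _ = z≤n
sumBelow-≤ (suc N) {g} ≤1 =
  subst (sumBelow N g + g N ≤_) (+-comm N 1) (+-mono-≤ (sumBelow-≤ N (≤1 ∘ m≤n⇒m≤1+n)) (≤1 ≤-refl))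

sumBelow≡N⇒≡1 : ∀ N {g} → (∀ {j} → j < N → g j ≤ 1) → sumBelow N g ≡ N → ∀ {j} → j < N → g j ≡ 1
sumBelow≡N⇒≡1 (suc N) {g} ≤1 sum≡ j< =
  [ sumBelow≡N⇒≡1 N (≤1 ∘ m≤n⇒m≤1+n) init≡N , (λ { refl → last≡1 }) ] (m<1+n⇒m<n∨m≡n j<)
  where
  init≤N : sumBelow N g ≤ N
  init≤N = sumBelow-≤ N (≤1 ∘ m≤n⇒m≤1+n)
  last≡1 : g N ≡ 1
  last≡1 = ≤-antisym (≤1 ≤-refl)
    (+-cancelˡ-≤ N 1 (g N) (subst₂ _≤_ (+-comm 1 N) refl
      (subst (_≤ N + g N) sum≡ (+-monoˡ-≤ (g N) init≤N))))
  init≡N : sumBelow N g ≡ N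
  init≡N = +-cancelʳ-≡ 1 (sumBelow N g) N (trans (cong (sumBelow N g +_) (sym last≡1)) (trans sum≡ (+-comm 1 N)))

words-length : ∀ L {w} → w ∈ words L → length w ≡ L
words-length zero (here refl) = refl
words-length (suc L) {w} w∈ with ∈-++⁻ (map (U ∷_) (words L)) w∈
... | inj₁ w∈U with _ , v∈ , refl ← ∈-map⁻ (U ∷_) w∈U = cong suc (words-length L v∈)
... | inj₂ w∈D with _ , v∈ , refl ← ∈-map⁻ (D ∷_) w∈D = cong suc (words-length L v∈)

∈-words : ∀ w → w ∈ words (length w)
∈-words [] = here refl
∈-words (U ∷ w) = ∈-++⁺ˡ (∈-map⁺ (U ∷_) (∈-words w))
∈-words (D ∷ w) = ∈-++⁺ʳ (map (U ∷_) (words (length w))) (∈-map⁺ (D ∷_) (∈-words w))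

words-unique : ∀ L → Unique (words L)
words-unique zero = [] ∷ []
words-unique (suc L) =
  Unique.++⁺ (Unique.map⁺ (λ { refl → refl }) (words-unique L))
             (Unique.map⁺ (λ { refl → refl }) (words-unique L))
             U≢D
  where
  U≢D : ∀ {w} → w ∈ map (U ∷_) (words L) × w ∈ map (D ∷_) (words L) → ⊥
  U≢D (w∈U , w∈D) with _ , _ , refl ← ∈-map⁻ (U ∷_) w∈U | _ , _ , () ← ∈-map⁻ (D ∷_) w∈D

∈-words-suc-elim : ∀ {ℓ} (P : List Step → Set ℓ) → (∀ x v → P (x ∷ v)) → ∀ L {w} → w ∈ words (suc L) → P w
∈-words-suc-elim P P∷ L {x ∷ v} _ = P∷ x v
∈-words-suc-elim P P∷ L {[]} w∈ with () ← words-length (suc L) w∈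

count-words-suc : (P : List Step → Bool) → ∀ L →
  count P (words (suc L)) ≡ count (P ∘ (U ∷_)) (words L) + count (P ∘ (D ∷_)) (words L)
count-words-suc P L =
  trans (count-++ P (map (U ∷_) (words L)) _) (cong₂ _+_ (count-map P (U ∷_) (words L)) (count-map P (D ∷_) (words L)))

heightFrom-++ : ∀ h xs ys → heightFrom h (xs ++ ys) ≡ heightFrom (heightFrom h xs) ys
heightFrom-++ h [] ys = refl
heightFrom-++ h (x ∷ xs) ys = heightFrom-++ (h ℤ.+ δ x) xs ys

heightFrom-+ : ∀ h k w → heightFrom (h ℤ.+ k) w ≡ h ℤ.+ heightFrom k w
heightFrom-+ h k [] = refl
heightFrom-+ h k (x ∷ w) = trans (cong (λ t → heightFrom t w) (ℤ.+-assoc h k (δ x))) (heightFrom-+ h (k ℤ.+ δ x) w)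

heightFrom-shift : ∀ h w → heightFrom h w ≡ h ℤ.+ heightFrom 0ℤ w
heightFrom-shift h w = trans (cong (λ t → heightFrom t w) (sym (ℤ.+-identityʳ h))) (heightFrom-+ h 0ℤ w)

heightFrom-rotate : ∀ xs ys → heightFrom 0ℤ (ys ++ xs) ≡ heightFrom 0ℤ (xs ++ ys)
heightFrom-rotate xs ys = begin
  heightFrom 0ℤ (ys ++ xs)                       ≡⟨ heightFrom-++ 0ℤ ys xs ⟩
  heightFrom (heightFrom 0ℤ ys) xs               ≡⟨ heightFrom-shift _ xs ⟩
  heightFrom 0ℤ ys ℤ.+ heightFrom 0ℤ xs          ≡⟨ ℤ.+-comm (heightFrom 0ℤ ys) _ ⟩
  heightFrom 0ℤ xs ℤ.+ heightFrom 0ℤ ys          ≡⟨ heightFrom-shift _ ys ⟨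
  heightFrom (heightFrom 0ℤ xs) ys               ≡⟨ heightFrom-++ 0ℤ xs ys ⟨
  heightFrom 0ℤ (xs ++ ys)                       ∎
  where open ≡-Reasoning

lastStep : Step → List Step → Step
lastStep x [] = x
lastStep x (y ∷ w) = lastStep y w

lastStep-++ : ∀ x xs y ys → lastStep x (xs ++ y ∷ ys) ≡ lastStep y ys
lastStep-++ x [] y ys = refl
lastStep-++ x (x′ ∷ xs) y ys = lastStep-++ x′ xs y ys

endsWith-lastStep : ∀ a x w → endsWith a (x ∷ w) ≡ (lastStep x w == a)
endsWith-lastStep a x [] = refl
endsWith-lastStep a x (y ∷ w) = endsWith-lastStep a y w

==⇒≡ : ∀ {x y} → T (x == y) → x ≡ y
==⇒≡ {U} {U} _ = refl
==⇒≡ {D} {D} _ = refl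

consIf : Bool → A → List A → List A
consIf true x xs = x ∷ xs
consIf false x xs = xs

consIf-++ : ∀ b (x : A) xs ys → consIf b x xs ++ ys ≡ consIf b x (xs ++ ys)
consIf-++ true x xs ys = refl
consIf-++ false x xs ys = refl

map-consIf : (f : A → B) → ∀ b x xs → map f (consIf b x xs) ≡ consIf b (f x) (map f xs)
map-consIf f true x xs = refl
map-consIf f false x xs = refl

count-consIf : (P : A → Bool) → ∀ b x xs → count P (consIf b x xs) ≡ toℕ (b ∧ P x) + count P xs
count-consIf P true x xs = refl
count-consIf P false x xs = refl

length-consIf : ∀ b (x : A) xs → length (consIf b x xs) ≡ toℕ b + length xs
length-consIf true x xs = refl
length-consIf false x xs = refl

∈-consIf⁻ : ∀ b {x z : A} {xs} → z ∈ consIf b x xs → (T b × z ≡ x) ⊎ z ∈ xs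
∈-consIf⁻ true (here z≡x) = inj₁ (tt , z≡x)
∈-consIf⁻ true (there z∈xs) = inj₂ z∈xs
∈-consIf⁻ false z∈xs = inj₂ z∈xs

consIf-unique : ∀ b {x : A} {xs} → x ∉ xs → Unique xs → Unique (consIf b x xs)
consIf-unique true x∉xs u = ¬Any⇒All¬ _ x∉xs ∷ u
consIf-unique false _ u = u

rotateAt : ℕ → List A → List A
rotateAt i w = drop i w ++ take i w

rotateAt-zero : ∀ (w : List A) → rotateAt 0 w ≡ w
rotateAt-zero = ++-identityʳ

rotateAt-++ : ∀ (xs ys : List A) → rotateAt (length xs + 0) (xs ++ ys) ≡ ys ++ xs
rotateAt-++ xs ys = trans (cong (λ i → rotateAt i (xs ++ ys)) (+-identityʳ (length xs))) (cong₂ _++_ (drop-++ xs) (take-++ xs))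
  where
  drop-++ : ∀ xs → drop (length xs) (xs ++ ys) ≡ ys
  drop-++ [] = refl
  drop-++ (x ∷ xs) = drop-++ xs
  take-++ : ∀ xs → take (length xs) (xs ++ ys) ≡ xs
  take-++ [] = refl
  take-++ (x ∷ xs) = cong (x ∷_) (take-++ xs)

ℤ+-cancelˡ-≤ : ∀ a {b c} → a ℤ.+ b ℤ.≤ a ℤ.+ c → b ℤ.≤ c
ℤ+-cancelˡ-≤ a {b} {c} le = subst₂ ℤ._≤_ (\\-leftDividesʳ a b) (\\-leftDividesʳ a c) (ℤ.+-monoʳ-≤ (ℤ.- a) le)

ℤ+-cancelˡ-< : ∀ a {b c} → a ℤ.+ b ℤ.< a ℤ.+ c → b ℤ.< c
ℤ+-cancelˡ-< a {b} {c} lt = subst₂ ℤ._<_ (\\-leftDividesʳ a b) (\\-leftDividesʳ a c) (ℤ.+-monoʳ-< (ℤ.- a) lt)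

ℤ≤⇒<⊎≡ : ∀ {i j} → i ℤ.≤ j → i ℤ.< j ⊎ i ≡ j
ℤ≤⇒<⊎≡ {i} {j} i≤j with i ℤ.≟ j
... | yes i≡j = inj₂ i≡j
... | no i≢j = inj₁ (ℤ.≤∧≢⇒< i≤j i≢j)

Vertex : Set
Vertex = ℕ × ℤ

index : Vertex → ℕ
index = proj₁

height : Vertex → ℤ
height = proj₂

shift : ℕ → ℤ → Vertex → Vertex
shift i h (q , H) = (i + q , h ℤ.+ H)

below : Vertex → Bool
below c = height c ℤ.≤ᵇ 0ℤ

module Junctions (J : Step → Step → Bool) where

  junctionsFrom : ℕ → ℤ → List Step → List Vertex
  junctionsFrom i h [] = []
  junctionsFrom i h (x ∷ []) = []
  junctionsFrom i h (x ∷ y ∷ w) = consIf (J x y) (suc i , h ℤ.+ δ x) (junctionsFrom (suc i) (h ℤ.+ δ x) (y ∷ w))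

  junctions : List Step → List Vertex
  junctions = junctionsFrom 0 0ℤ

  junctionsFrom-++ : ∀ x xs y ys i h →
    junctionsFrom i h ((x ∷ xs) ++ (y ∷ ys)) ≡
      junctionsFrom i h (x ∷ xs) ++
      consIf (J (lastStep x xs) y) (length (x ∷ xs) + i , heightFrom h (x ∷ xs))
             (junctionsFrom (length (x ∷ xs) + i) (heightFrom h (x ∷ xs)) (y ∷ ys))
  junctionsFrom-++ x [] y ys i h = refl
  junctionsFrom-++ x (x′ ∷ xs) y ys i h
    rewrite junctionsFrom-++ x′ xs y ys (suc i) (h ℤ.+ δ x) | +-suc (length xs) i =
      sym (consIf-++ (J x x′) _ _ _)

  junctionsFrom-bounds : ∀ i h w {c} → c ∈ junctionsFrom i h w → i < index c × index c < i + length w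
  junctionsFrom-bounds i h (x ∷ w@(y ∷ w′)) {c} c∈ =
    [ (λ { (_ , refl) → ≤-refl , subst (suc i <_) (+-comm (suc (suc (length w′))) i) (s≤s (s≤s (m≤n+m i _))) })
    , (λ c∈′ → let i<c , c<i+ = junctionsFrom-bounds (suc i) (h ℤ.+ δ x) w c∈′
               in <-trans ≤-refl i<c , subst (index c <_) (sym (+-suc i (length w))) c<i+)
    ] (∈-consIf⁻ (J x y) c∈)

  junctionsFrom-unique : ∀ i h w → Unique (junctionsFrom i h w)
  junctionsFrom-unique i h [] = []
  junctionsFrom-unique i h (x ∷ []) = []
  junctionsFrom-unique i h (x ∷ y ∷ w) =
    consIf-unique (J x y) (λ c∈ → <-irrefl refl (proj₁ (junctionsFrom-bounds (suc i) _ (y ∷ w) c∈)))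
                  (junctionsFrom-unique (suc i) _ (y ∷ w))

  length-junctionsFrom : ∀ i h i′ h′ w → length (junctionsFrom i h w) ≡ length (junctionsFrom i′ h′ w)
  length-junctionsFrom i h i′ h′ [] = refl
  length-junctionsFrom i h i′ h′ (x ∷ []) = refl
  length-junctionsFrom i h i′ h′ (x ∷ y ∷ w) =
    trans (length-consIf (J x y) _ _)
      (trans (cong (toℕ (J x y) +_) (length-junctionsFrom (suc i) _ (suc i′) _ (y ∷ w)))
             (sym (length-consIf (J x y) _ _)))

  junctionsFrom-shift : ∀ i h i₀ h₀ w →
    junctionsFrom (i + i₀) (h ℤ.+ h₀) w ≡ map (shift i h) (junctionsFrom i₀ h₀ w)
  junctionsFrom-shift i h i₀ h₀ [] = refl
  junctionsFrom-shift i h i₀ h₀ (x ∷ []) = refl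
  junctionsFrom-shift i h i₀ h₀ (x ∷ y ∷ w) = begin
    consIf (J x y) (suc (i + i₀) , h ℤ.+ h₀ ℤ.+ δ x) (junctionsFrom (suc (i + i₀)) (h ℤ.+ h₀ ℤ.+ δ x) (y ∷ w))
      ≡⟨ cong₂ (λ p q → consIf (J x y) (p , q) (junctionsFrom p q (y ∷ w)))
               (sym (+-suc i i₀)) (ℤ.+-assoc h h₀ (δ x)) ⟩
    consIf (J x y) (shift i h (suc i₀ , h₀ ℤ.+ δ x)) (junctionsFrom (i + suc i₀) (h ℤ.+ (h₀ ℤ.+ δ x)) (y ∷ w))
      ≡⟨ cong (consIf (J x y) _) (junctionsFrom-shift i h (suc i₀) (h₀ ℤ.+ δ x) (y ∷ w)) ⟩
    consIf (J x y) (shift i h (suc i₀ , h₀ ℤ.+ δ x)) (map (shift i h) (junctionsFrom (suc i₀) (h₀ ℤ.+ δ x) (y ∷ w)))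
      ≡⟨ map-consIf (shift i h) (J x y) _ _ ⟨
    map (shift i h) (junctionsFrom i₀ h₀ (x ∷ y ∷ w)) ∎
    where open ≡-Reasoning

  junctions-shift : ∀ i h w → junctionsFrom (i + 0) h w ≡ map (shift i h) (junctions w)
  junctions-shift i h w = trans (cong (λ t → junctionsFrom (i + 0) t w) (sym (ℤ.+-identityʳ h)))
                                (junctionsFrom-shift i h 0 0ℤ w)

  length-junctions-++ : ∀ x xs y ys →
    length (junctions ((x ∷ xs) ++ (y ∷ ys)))
      ≡ length (junctions (x ∷ xs)) + (toℕ (J (lastStep x xs) y) + length (junctions (y ∷ ys)))
  length-junctions-++ x xs y ys =
    trans (cong length (junctionsFrom-++ x xs y ys 0 0ℤ))
          (trans (length-++ (junctions (x ∷ xs)))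
                 (cong (length (junctions (x ∷ xs)) +_)
                       (trans (length-consIf (J (lastStep x xs) y) _ _)
                              (cong (toℕ (J (lastStep x xs) y) +_) (length-junctionsFrom _ _ 0 0ℤ (y ∷ ys))))))

  length-junctions-rotate : ∀ x xs y ys → J (lastStep x xs) y ≡ J (lastStep y ys) x →
    length (junctions ((y ∷ ys) ++ (x ∷ xs))) ≡ length (junctions ((x ∷ xs) ++ (y ∷ ys)))
  length-junctions-rotate x xs y ys same = begin
    length (junctions (Y ++ X))                ≡⟨ length-junctions-++ y ys x xs ⟩
    #Y + (toℕ (J (lastStep y ys) x) + #X)     ≡⟨ cong (λ b → #Y + (toℕ b + #X)) (sym same) ⟩
    #Y + (toℕ (J (lastStep x xs) y) + #X)     ≡⟨ swap #Y _ #X ⟩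
    #X + (toℕ (J (lastStep x xs) y) + #Y)     ≡⟨ length-junctions-++ x xs y ys ⟨
    length (junctions (X ++ Y))                ∎
    where
    open ≡-Reasoning
    X = x ∷ xs
    Y = y ∷ ys
    #X = length (junctions X)
    #Y = length (junctions Y)
    swap : ∀ p q r → p + (q + r) ≡ r + (q + p)
    swap = ℕ-solve-∀

  record SplitAt (i : ℕ) (h : ℤ) (w : List Step) (c : Vertex) : Set where
    constructor splitAt
    field
      x : Step
      xs : List Step
      y : Step
      ys : List Step
      w≡ : w ≡ (x ∷ xs) ++ (y ∷ ys)
      junction : T (J (lastStep x xs) y)
      c≡ : c ≡ (length (x ∷ xs) + i , heightFrom h (x ∷ xs))

  split : ∀ i h w {c} → c ∈ junctionsFrom i h w → SplitAt i h w c
  split i h (x ∷ w@(y ∷ w′)) c∈ =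
    [ (λ { (Jxy , refl) → splitAt x [] y w′ refl Jxy refl })
    , (λ c∈′ → extend (split (suc i) (h ℤ.+ δ x) w c∈′))
    ] (∈-consIf⁻ (J x y) c∈)
    where
    extend : ∀ {c} → SplitAt (suc i) (h ℤ.+ δ x) w c → SplitAt i h (x ∷ w) c
    extend (splitAt x′ xs y′ ys refl Jxy refl) =
      splitAt x (x′ ∷ xs) y′ ys refl Jxy (cong (_, heightFrom (h ℤ.+ δ x) (x′ ∷ xs)) (+-suc (length (x′ ∷ xs)) i))

_≺_ : Vertex → Vertex → Set
c ≺ d = height c ℤ.< height d ⊎ (height c ≡ height d × index d < index c)

_≺?_ : ∀ c d → Dec (c ≺ d)
c ≺? d with height c ℤ.<? height d | height c ℤ.≟ height d | index d <? index c
... | yes c<d | _ | _ = yes (inj₁ c<d)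
... | no c≮d | yes c≡d | yes d<c = yes (inj₂ (c≡d , d<c))
... | no c≮d | no c≢d | _ = no [ c≮d , c≢d ∘ proj₁ ]
... | no c≮d | yes _ | no d≮c = no [ c≮d , d≮c ∘ proj₂ ]

≺-irrefl : ∀ {c} → ¬ (c ≺ c)
≺-irrefl (inj₁ c<c) = ℤ.<-irrefl refl c<c
≺-irrefl (inj₂ (_ , c<c)) = <-irrefl refl c<c

≺-trans : ∀ {c d e} → c ≺ d → d ≺ e → c ≺ e
≺-trans (inj₁ c<d) (inj₁ d<e) = inj₁ (ℤ.<-trans c<d d<e)
≺-trans (inj₁ c<d) (inj₂ (d≡e , _)) = inj₁ (subst (_ ℤ.<_) d≡e c<d)
≺-trans (inj₂ (c≡d , _)) (inj₁ d<e) = inj₁ (subst (ℤ._< _) (sym c≡d) d<e)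
≺-trans (inj₂ (c≡d , d<c)) (inj₂ (d≡e , e<d)) = inj₂ (trans c≡d d≡e , <-trans e<d d<c)

≺-trichotomy : ∀ c d → c ≺ d ⊎ c ≡ d ⊎ d ≺ c
≺-trichotomy (q , H) (r , H′) with ℤ.<-cmp H H′
... | tri< H<H′ _ _ = inj₁ (inj₁ H<H′)
... | tri> _ _ H′<H = inj₂ (inj₂ (inj₁ H′<H))
... | tri≈ _ refl _ with <-cmp q r
...   | tri< q<r _ _ = inj₂ (inj₂ (inj₂ (refl , q<r)))
...   | tri≈ _ refl _ = inj₂ (inj₁ refl)
...   | tri> _ _ r<q = inj₁ (inj₂ (refl , r<q))

rank : List Vertex → Vertex → ℕ
rank cs d = count (λ c → isYes (c ≺? d)) cs

rank-<-length : ∀ cs {d} → d ∈ cs → rank cs d < length cs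
rank-<-length cs d∈ = count-<-length _ d∈ (≺-irrefl ∘ toWitness)

rank-mono : ∀ cs {c d} → c ∈ cs → c ≺ d → rank cs c < rank cs d
rank-mono cs c∈ c≺d =
  count-mono-< _ _ (λ _ e≺c → fromWitness (≺-trans (toWitness e≺c) c≺d)) c∈ (fromWitness c≺d) (≺-irrefl ∘ toWitness)

rank-injective : ∀ cs {c d} → c ∈ cs → d ∈ cs → rank cs c ≡ rank cs d → c ≡ d
rank-injective cs {c} {d} c∈ d∈ eq with ≺-trichotomy c d
... | inj₁ c≺d = ⊥-elim (<-irrefl eq (rank-mono cs c∈ c≺d))
... | inj₂ (inj₁ c≡d) = c≡d
... | inj₂ (inj₂ d≺c) = ⊥-elim (<-irrefl (sym eq) (rank-mono cs d∈ d≺c))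

-- The fibres of rank have size at most 1 and their sizes add up to the length, so none is empty.
rank-surjective : ∀ {cs} → Unique cs → ∀ {j} → j < length cs → ∃[ d ] (d ∈ cs × rank cs d ≡ j)
rank-surjective {cs} u {j} j< =
  let d , d∈ , rank≡ = count-pos⇒∃ _ cs (≤-reflexive (sym (sumBelow≡N⇒≡1 (length cs) ≤1 total j<)))
  in d , d∈ , ≡ᵇ⇒≡ _ _ rank≡
  where
  fibre : ℕ → ℕ
  fibre j = count (λ d → true ∧ (rank cs d ≡ᵇ j)) cs
  ≤1 : ∀ {j} → j < length cs → fibre j ≤ 1
  ≤1 _ = count≤1 _ u (λ c∈ d∈ c↦j d↦j →
           rank-injective cs c∈ d∈ (trans (≡ᵇ⇒≡ _ _ c↦j) (sym (≡ᵇ⇒≡ _ _ d↦j))))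
  total : sumBelow (length cs) fibre ≡ length cs
  total = trans (sumBelow-count (length cs) (λ _ → true) (rank cs) cs)
                (count-all _ cs (λ d∈ → <⇒<ᵇ (rank-<-length cs d∈)))

≺?-irrefl : ∀ c → isYes (c ≺? c) ≡ false
≺?-irrefl c = ¬T⇒≡false (≺-irrefl ∘ toWitness)

below-≺-shift : ∀ L h e → 0 < index e → below e ≡ isYes (shift L h e ≺? (L + 0 , h))
below-≺-shift L h (q , H) 0<q = T-ext (fromWitness ∘ to ∘ ℤ.≤ᵇ⇒≤) (ℤ.≤⇒≤ᵇ ∘ from ∘ toWitness)
  where
  h+0≡h = ℤ.+-identityʳ h
  to : H ℤ.≤ 0ℤ → shift L h (q , H) ≺ (L + 0 , h)
  to H≤0 with ℤ≤⇒<⊎≡ H≤0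
  ... | inj₁ H<0 = inj₁ (subst (h ℤ.+ H ℤ.<_) h+0≡h (ℤ.+-monoʳ-< h H<0))
  ... | inj₂ refl = inj₂ (h+0≡h , +-monoʳ-< L 0<q)
  from : shift L h (q , H) ≺ (L + 0 , h) → H ℤ.≤ 0ℤ
  from (inj₁ h+H<h) = ℤ.<⇒≤ (ℤ+-cancelˡ-< h (subst (h ℤ.+ H ℤ.<_) (sym h+0≡h) h+H<h))
  from (inj₂ (h+H≡h , _)) = ℤ.≤-reflexive (ℤ+-cancelˡ-≡ h H 0ℤ (trans h+H≡h (sym h+0≡h)))

below-≺-origin : ∀ e → 0 < index e → below e ≡ isYes (e ≺? (0 , 0ℤ))
below-≺-origin (q , H) 0<q =
  trans (below-≺-shift 0 0ℤ (q , H) 0<q) (cong (λ t → isYes ((q , t) ≺? (0 , 0ℤ))) (ℤ.+-identityˡ H))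

below-shift-≺ : ∀ L M {hx hy} → hx ℤ.+ hy ≡ 1ℤ → ∀ e → index e < L →
                below (shift M hy e) ≡ isYes (e ≺? (L + 0 , hx))
below-shift-≺ L M {hx} {hy} hx+hy≡1 (q , H) q<L =
  T-ext (fromWitness ∘ to ∘ ℤ.≤ᵇ⇒≤) (ℤ.≤⇒≤ᵇ ∘ from ∘ toWitness)
  where
  hx+[hy+H]≡1+H : hx ℤ.+ (hy ℤ.+ H) ≡ 1ℤ ℤ.+ H
  hx+[hy+H]≡1+H = trans (sym (ℤ.+-assoc hx hy H)) (cong (ℤ._+ H) hx+hy≡1)
  to : hy ℤ.+ H ℤ.≤ 0ℤ → (q , H) ≺ (L + 0 , hx)
  to hy+H≤0 = inj₁ (ℤ.suc[i]≤j⇒i<j (subst₂ ℤ._≤_ hx+[hy+H]≡1+H (ℤ.+-identityʳ hx) (ℤ.+-monoʳ-≤ hx hy+H≤0)))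
  from : (q , H) ≺ (L + 0 , hx) → hy ℤ.+ H ℤ.≤ 0ℤ
  from (inj₁ H<hx) =
    ℤ+-cancelˡ-≤ hx (subst₂ ℤ._≤_ (sym hx+[hy+H]≡1+H) (sym (ℤ.+-identityʳ hx)) (ℤ.i<j⇒suc[i]≤j H<hx))
  from (inj₂ (_ , L<q)) = ⊥-elim (<-asym L<q (subst (q <_) (sym (+-identityʳ L)) q<L))

-- The cycle lemma

module Rotation (J : Step → Step → Bool) where

  open Junctions J public

  -- When w closes, the seam between its last and first step is one more junction of the cyclic word.
  cuts : List Step → List Vertex
  cuts w = (0 , 0ℤ) ∷ junctions w

  belowCount : List Step → ℕ
  belowCount w = count below (junctions w)

  closes : List Step → Bool
  closes [] = false
  closes (x ∷ w) = J (lastStep x w) x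

  cuts-unique : ∀ w → Unique (cuts w)
  cuts-unique w = consIf-unique true (λ o∈ → <-irrefl refl (proj₁ (junctionsFrom-bounds 0 0ℤ w o∈)))
                                (junctionsFrom-unique 0 0ℤ w)

  count-junctions-++ : (P : Vertex → Bool) → ∀ x xs y ys → let X = x ∷ xs in
    count P (junctions (X ++ (y ∷ ys))) ≡
      count P (junctions X) + (toℕ (J (lastStep x xs) y ∧ P (length X + 0 , heightFrom 0ℤ X))
                               + count P (junctionsFrom (length X + 0) (heightFrom 0ℤ X) (y ∷ ys)))
  count-junctions-++ P x xs y ys =
    trans (cong (count P) (junctionsFrom-++ x xs y ys 0 0ℤ))
          (trans (count-++ P (junctions (x ∷ xs)) _)
                 (cong (count P (junctions (x ∷ xs)) +_) (count-consIf P (J (lastStep x xs) y) _ _)))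

  belowCount≡rank-origin : ∀ w → belowCount w ≡ rank (cuts w) (0 , 0ℤ)
  belowCount≡rank-origin w = begin
    count below (junctions w)
      ≡⟨ count-cong _ _ _ (λ {e} e∈ → below-≺-origin e (proj₁ (junctionsFrom-bounds 0 0ℤ w e∈))) ⟩
    count P (junctions w)
      ≡⟨ cong (λ b → toℕ b + count P (junctions w)) (≺?-irrefl (0 , 0ℤ)) ⟨
    rank (cuts w) (0 , 0ℤ) ∎
    where
    open ≡-Reasoning
    P = λ e → isYes (e ≺? (0 , 0ℤ))

  -- Cutting at c, exactly the junctions ≺ c end up on or below the axis; here the final height 1 is used.
  belowCount-rotate : ∀ w → T (closes w) → heightFrom 0ℤ w ≡ 1ℤ → ∀ {c} → c ∈ junctions w →
                      belowCount (rotateAt (index c) w) ≡ rank (cuts w) c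
  belowCount-rotate w closed h≡1 c∈ with split 0 0ℤ w c∈
  ... | splitAt x xs y ys refl Jxy refl = begin
    belowCount (rotateAt (length X + 0) (X ++ Y))
      ≡⟨ cong belowCount (rotateAt-++ X Y) ⟩
    count below (junctions (Y ++ X))
      ≡⟨ count-junctions-++ below y ys x xs ⟩
    count below (junctions Y) + (toℕ (J (lastStep y ys) x ∧ below (length Y + 0 , hy))
                                 + count below (junctionsFrom (length Y + 0) hy X))
      ≡⟨ cong₂ _+_ after (cong₂ _+_ wrap before) ⟩
    count P (junctionsFrom (length X + 0) hx Y) + (toℕ (P (0 , 0ℤ)) + count P (junctions X))
      ≡⟨ trans (+-comm (count P (junctionsFrom (length X + 0) hx Y)) _) (+-assoc (toℕ (P (0 , 0ℤ))) _ _) ⟩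
    toℕ (P (0 , 0ℤ)) + (count P (junctions X) + (0 + count P (junctionsFrom (length X + 0) hx Y)))
      ≡⟨ cong (λ b → toℕ (P (0 , 0ℤ)) + (count P (junctions X) + (toℕ b + count P (junctionsFrom (length X + 0) hx Y))))
              (trans (cong (J (lastStep x xs) y ∧_) (≺?-irrefl c)) (∧-zeroʳ _)) ⟨
    toℕ (P (0 , 0ℤ)) + (count P (junctions X) + (toℕ (J (lastStep x xs) y ∧ P c)
                                                  + count P (junctionsFrom (length X + 0) hx Y)))
      ≡⟨ cong (toℕ (P (0 , 0ℤ)) +_) (count-junctions-++ P x xs y ys) ⟨
    rank (cuts (X ++ Y)) c ∎
    where
    open ≡-Reasoning
    X = x ∷ xs
    Y = y ∷ ys
    hx = heightFrom 0ℤ X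
    hy = heightFrom 0ℤ Y
    c = (length X + 0 , hx)
    P = λ e → isYes (e ≺? c)
    hx+hy≡1 : hx ℤ.+ hy ≡ 1ℤ
    hx+hy≡1 = trans (sym (heightFrom-shift hx Y)) (trans (sym (heightFrom-++ 0ℤ X Y)) h≡1)
    after : count below (junctions Y) ≡ count P (junctionsFrom (length X + 0) hx Y)
    after = begin
      count below (junctions Y)
        ≡⟨ count-cong _ _ _ (λ {e} e∈ → below-≺-shift (length X) hx e (proj₁ (junctionsFrom-bounds 0 0ℤ Y e∈))) ⟩
      count (P ∘ shift (length X) hx) (junctions Y)          ≡⟨ count-map P (shift (length X) hx) (junctions Y) ⟨
      count P (map (shift (length X) hx) (junctions Y))      ≡⟨ cong (count P) (junctions-shift (length X) hx Y) ⟨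
      count P (junctionsFrom (length X + 0) hx Y)            ∎
    before : count below (junctionsFrom (length Y + 0) hy X) ≡ count P (junctions X)
    before = begin
      count below (junctionsFrom (length Y + 0) hy X)        ≡⟨ cong (count below) (junctions-shift (length Y) hy X) ⟩
      count below (map (shift (length Y) hy) (junctions X))  ≡⟨ count-map below (shift (length Y) hy) (junctions X) ⟩
      count (below ∘ shift (length Y) hy) (junctions X)
        ≡⟨ count-cong _ _ _ (λ {e} e∈ →
             below-shift-≺ (length X) (length Y) hx+hy≡1 e (proj₂ (junctionsFrom-bounds 0 0ℤ X e∈))) ⟩
      count P (junctions X)                                  ∎
    wrap : toℕ (J (lastStep y ys) x ∧ below (length Y + 0 , hy)) ≡ toℕ (P (0 , 0ℤ))
    wrap = cong toℕ (begin
      J (lastStep y ys) x ∧ below (length Y + 0 , hy)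
        ≡⟨ cong (_∧ _) (T⇒≡true (subst (λ s → T (J s x)) (lastStep-++ x xs y ys) closed)) ⟩
      hy ℤ.≤ᵇ 0ℤ                                          ≡⟨ cong (ℤ._≤ᵇ 0ℤ) (ℤ.+-identityʳ hy) ⟨
      below (shift (length Y) hy (0 , 0ℤ))
        ≡⟨ below-shift-≺ (length X) (length Y) hx+hy≡1 (0 , 0ℤ) (s≤s z≤n) ⟩
      P (0 , 0ℤ)                                          ∎)

  rotationWith : ℕ → List Vertex → List Step → List Step
  rotationWith j [] w = w
  rotationWith j (c ∷ cs) w =
    if belowCount (rotateAt (index c) w) ≡ᵇ j then rotateAt (index c) w else rotationWith j cs w

  rotationWith-spec : ∀ j cs w {c} → c ∈ cs → belowCount (rotateAt (index c) w) ≡ j →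
    ∃[ d ] (d ∈ cs × rotationWith j cs w ≡ rotateAt (index d) w × belowCount (rotateAt (index d) w) ≡ j)
  rotationWith-spec j (c ∷ cs) w c′∈ c′↦j with belowCount (rotateAt (index c) w) ≡ᵇ j in eq
  ... | true = c , here refl , refl , ≡ᵇ⇒≡ _ _ (subst T (sym eq) tt)
  rotationWith-spec j (c ∷ cs) w (here refl) c↦j | false = ⊥-elim (subst T eq (≡⇒≡ᵇ _ _ c↦j))
  rotationWith-spec j (c ∷ cs) w (there c′∈) c′↦j | false =
    let d , d∈ , eq′ , d↦j = rotationWith-spec j cs w c′∈ c′↦j in d , there d∈ , eq′ , d↦j

  module Uniform (W : List Step → Bool) (L m : ℕ)
    (W-closes : ∀ {w} → T (W w) → T (closes w))
    (W-height : ∀ {w} → T (W w) → heightFrom 0ℤ w ≡ 1ℤ)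
    (W-junctions : ∀ {w} → length w ≡ L → T (W w) → length (junctions w) ≡ m)
    (W-rotate : ∀ x xs y ys → T (J (lastStep x xs) y) → T (W ((x ∷ xs) ++ (y ∷ ys))) → T (W ((y ∷ ys) ++ (x ∷ xs))))
    where

    W-rotateAt : ∀ {w} → T (W w) → ∀ {c} → c ∈ cuts w →
                 T (W (rotateAt (index c) w)) × length (rotateAt (index c) w) ≡ length w
    W-rotateAt {w} Ww (here refl) = subst (λ v → T (W v) × length v ≡ length w) (sym (rotateAt-zero w)) (Ww , refl)
    W-rotateAt {w} Ww (there c∈) with split 0 0ℤ w c∈
    ... | splitAt x xs y ys refl Jxy refl =
      subst (λ v → T (W v) × length v ≡ length (X ++ Y)) (sym (rotateAt-++ X Y))
            (W-rotate x xs y ys Jxy Ww , trans (length-++ Y) (trans (+-comm (length Y) _) (sym (length-++ X))))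
      where
      X = x ∷ xs
      Y = y ∷ ys

    belowCount-rotateAt : ∀ {w} → T (W w) → ∀ {c} → c ∈ cuts w → belowCount (rotateAt (index c) w) ≡ rank (cuts w) c
    belowCount-rotateAt {w} Ww (here refl) = trans (cong belowCount (rotateAt-zero w)) (belowCount≡rank-origin w)
    belowCount-rotateAt {w} Ww (there c∈) = belowCount-rotate w (W-closes Ww) (W-height Ww) c∈

    rotateAt-inverse : ∀ {w} → T (W w) → ∀ {c} → c ∈ cuts w →
      ∃[ d ] (d ∈ cuts (rotateAt (index c) w) × rotateAt (index d) (rotateAt (index c) w) ≡ w)
    rotateAt-inverse {w} Ww (here refl) = (0 , 0ℤ) , here refl , trans (rotateAt-zero _) (rotateAt-zero w)
    rotateAt-inverse {w} Ww (there c∈) with split 0 0ℤ w c∈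
    ... | splitAt x xs y ys refl Jxy refl =
      subst (λ v → ∃[ d ] (d ∈ cuts v × rotateAt (index d) v ≡ X ++ Y)) (sym (rotateAt-++ X Y))
            (d , there d∈ , rotateAt-++ Y X)
      where
      X = x ∷ xs
      Y = y ∷ ys
      d = (length Y + 0 , heightFrom 0ℤ Y)
      Jyx : J (lastStep y ys) x ≡ true
      Jyx = T⇒≡true (subst (λ s → T (J s x)) (lastStep-++ x xs y ys) (W-closes Ww))
      d∈ : d ∈ junctions (Y ++ X)
      d∈ = subst (d ∈_) (sym (junctionsFrom-++ y ys x xs 0 0ℤ))
                 (∈-++⁺ʳ (junctions Y) (subst (λ b → d ∈ consIf b d (junctionsFrom (length Y + 0) (heightFrom 0ℤ Y) X))
                                              (sym Jyx) (here refl)))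

    belowCount-< : ∀ {w} → length w ≡ L → T (W w) → belowCount w < suc m
    belowCount-< {w} len Ww =
      subst (belowCount w <_) (cong suc (W-junctions len Ww))
            (subst (_< length (cuts w)) (sym (belowCount≡rank-origin w)) (rank-<-length (cuts w) (here refl)))

    rotation-with-belowCount : ∀ {w} → length w ≡ L → T (W w) → ∀ {j} → j ≤ m →
      ∃[ c ] (c ∈ cuts w × belowCount (rotateAt (index c) w) ≡ j)
    rotation-with-belowCount {w} len Ww {j} j≤m =
      let d , d∈ , rank≡ = rank-surjective (cuts-unique w) (subst (j <_) (sym (cong suc (W-junctions len Ww))) (s≤s j≤m))
      in d , d∈ , trans (belowCount-rotateAt Ww d∈) rank≡

    Wj : ℕ → List Step → Bool
    Wj j w = W w ∧ (belowCount w ≡ᵇ j)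

    rotationWith-cuts : ∀ {j w} → length w ≡ L → T (W w) → j ≤ m →
      ∃[ d ] (d ∈ cuts w × rotationWith j (cuts w) w ≡ rotateAt (index d) w × belowCount (rotateAt (index d) w) ≡ j)
    rotationWith-cuts {j} {w} len Ww j≤m =
      let c , c∈ , c↦j = rotation-with-belowCount len Ww j≤m in rotationWith-spec j (cuts w) w c∈ c↦j

    -- Rotating to the cut with below-count j′ maps Wj j injectively into Wj j′.
    count-Wj-≤ : ∀ {j j′} → j ≤ m → j′ ≤ m → count (Wj j) (words L) ≤ count (Wj j′) (words L)
    count-Wj-≤ {j} {j′} j≤m j′≤m =
      count-≤-injection (Wj j) (Wj j′) (λ w → rotationWith j′ (cuts w) w) (words-unique L) into inj
      where
      into : ∀ {w} → w ∈ words L → T (Wj j w) →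
             rotationWith j′ (cuts w) w ∈ words L × T (Wj j′ (rotationWith j′ (cuts w) w))
      into {w} w∈ Wjw =
        let len = words-length L w∈
            Ww , _ = T-∧⁻ {W w} Wjw
            d , d∈ , eq , d↦j′ = rotationWith-cuts len Ww j′≤m
            Wd , len-d = W-rotateAt Ww d∈
        in subst (_∈ words L) (sym eq) (subst (λ n → rotateAt (index d) w ∈ words n) (trans len-d len) (∈-words _))
         , subst (T ∘ Wj j′) (sym eq) (T-∧⁺ Wd (≡⇒≡ᵇ _ _ d↦j′))
      inj : ∀ {w₁ w₂} → w₁ ∈ words L → w₂ ∈ words L → T (Wj j w₁) → T (Wj j w₂) →
            rotationWith j′ (cuts w₁) w₁ ≡ rotationWith j′ (cuts w₂) w₂ → w₁ ≡ w₂
      inj {w₁} {w₂} w₁∈ w₂∈ Wj₁ Wj₂ eq =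
        let W₁ , j₁ = T-∧⁻ {W w₁} Wj₁
            W₂ , j₂ = T-∧⁻ {W w₂} Wj₂
            c₁ , c₁∈ , eq₁ , _ = rotationWith-cuts (words-length L w₁∈) W₁ j′≤m
            c₂ , c₂∈ , eq₂ , _ = rotationWith-cuts (words-length L w₂∈) W₂ j′≤m
            u = rotateAt (index c₁) w₁
            Wu = proj₁ (W-rotateAt W₁ c₁∈)
            u₂≡u : rotateAt (index c₂) w₂ ≡ u
            u₂≡u = trans (sym eq₂) (trans (sym eq) eq₁)
            d₁ , d₁∈ , back₁ = rotateAt-inverse W₁ c₁∈
            d₂ , d₂∈′ , back₂′ = rotateAt-inverse W₂ c₂∈
            d₂∈ = subst (λ v → d₂ ∈ cuts v) u₂≡u d₂∈′
            back₂ = trans (cong (rotateAt (index d₂)) (sym u₂≡u)) back₂′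
            rank₁ = trans (sym (belowCount-rotateAt Wu d₁∈)) (trans (cong belowCount back₁) (≡ᵇ⇒≡ _ _ j₁))
            rank₂ = trans (sym (belowCount-rotateAt Wu d₂∈)) (trans (cong belowCount back₂) (≡ᵇ⇒≡ _ _ j₂))
            d₁≡d₂ = rank-injective (cuts u) d₁∈ d₂∈ (trans rank₁ (sym rank₂))
        in trans (sym back₁) (trans (cong (λ d → rotateAt (index d) u) d₁≡d₂) back₂)

    uniform : ∀ {j} → j ≤ m → suc m * count (Wj j) (words L) ≡ count W (words L)
    uniform {j} j≤m = sym (begin
      count W (words L)
        ≡⟨ count-cong _ _ (words L) (λ w∈ → W≡W∧< (words-length L w∈)) ⟩
      count (λ w → W w ∧ (belowCount w <ᵇ suc m)) (words L)
        ≡⟨ sumBelow-count (suc m) W belowCount (words L) ⟨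
      sumBelow (suc m) (λ k → count (Wj k) (words L))
        ≡⟨ sumBelow-cong (suc m) (λ k< → ≤-antisym (count-Wj-≤ (s≤s⁻¹ k<) j≤m) (count-Wj-≤ j≤m (s≤s⁻¹ k<))) ⟩
      sumBelow (suc m) (λ _ → count (Wj j) (words L))
        ≡⟨ sumBelow-const (suc m) _ ⟩
      suc m * count (Wj j) (words L) ∎)
      where
      open ≡-Reasoning
      W≡W∧< : ∀ {w} → length w ≡ L → W w ≡ (W w ∧ (belowCount w <ᵇ suc m))
      W≡W∧< {w} len with W w in eq
      ... | false = refl
      ... | true = sym (T⇒≡true (<⇒<ᵇ (belowCount-< len (subst T (sym eq) tt))))

-- Runs

steps : Step → List Step → ℕ
steps s = count (_== s)

upRuns : List Step → ℕ
upRuns [] = 0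
upRuns (x ∷ w) = toℕ ((x == U) ∧ not (startsWith U w)) + upRuns w

upRuns-pos : ∀ {w} → startsWith U w ≡ true → 1 ≤ upRuns w
upRuns-pos {U ∷ []} _ = s≤s z≤n
upRuns-pos {U ∷ U ∷ w} _ = upRuns-pos {U ∷ w} refl
upRuns-pos {U ∷ D ∷ w} _ = s≤s z≤n

compositions : ℕ → ℕ → ℕ
compositions zero zero = 1
compositions zero (suc r) = 0
compositions (suc p) zero = 0
compositions (suc p) (suc r) = compositions p r + compositions p (suc r)

compositions-suc-suc : ∀ p r → compositions (suc p) (suc r) ≡ p C r
compositions-suc-suc zero zero = refl
compositions-suc-suc zero (suc r) = refl
compositions-suc-suc (suc p) zero = compositions-suc-suc p zero
compositions-suc-suc (suc p) (suc r) =
  trans (cong₂ _+_ (compositions-suc-suc p r) (compositions-suc-suc p (suc r))) (nCk+nC[k+1]≡[n+1]C[k+1] p r)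

Profile : Step → Step → ℕ → ℕ → ℕ → List Step → Bool
Profile x y p q r w = startsWith x w ∧ (endsWith y w ∧ ((steps U w ≡ᵇ p) ∧ ((steps D w ≡ᵇ q) ∧ (upRuns w ≡ᵇ r))))

-- The r up-runs and the down-runs between them are compositions of p and q respectively.
profileCount : Step → Step → ℕ → ℕ → ℕ → ℕ
profileCount U U p q zero = 0
profileCount U U p q (suc r) = compositions p (suc r) * compositions q r
profileCount U D p q zero = 0
profileCount U D p q (suc r) = compositions p (suc r) * compositions q (suc r)
profileCount D U p q r = compositions p r * compositions q r
profileCount D D p q r = compositions p r * compositions q (suc r)

count-Profile-single : ∀ x y p q r → p + q ≡ 1 → count (Profile x y p q r) (words 1) ≡ profileCount x y p q r
count-Profile-single U U 0 1 0 refl = refl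
count-Profile-single U U 0 1 1 refl = refl
count-Profile-single U U 0 1 (suc (suc r)) refl = refl
count-Profile-single U U 1 0 0 refl = refl
count-Profile-single U U 1 0 1 refl = refl
count-Profile-single U U 1 0 (suc (suc r)) refl = refl
count-Profile-single U D 0 1 0 refl = refl
count-Profile-single U D 0 1 1 refl = refl
count-Profile-single U D 0 1 (suc (suc r)) refl = refl
count-Profile-single U D 1 0 0 refl = refl
count-Profile-single U D 1 0 1 refl = refl
count-Profile-single U D 1 0 (suc (suc r)) refl = refl
count-Profile-single D U 0 1 0 refl = refl
count-Profile-single D U 0 1 1 refl = refl
count-Profile-single D U 0 1 (suc (suc r)) refl = refl
count-Profile-single D U 1 0 0 refl = refl
count-Profile-single D U 1 0 1 refl = refl
count-Profile-single D U 1 0 (suc (suc r)) refl = refl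
count-Profile-single D D 0 1 0 refl = refl
count-Profile-single D D 0 1 1 refl = refl
count-Profile-single D D 0 1 (suc (suc r)) refl = refl
count-Profile-single D D 1 0 0 refl = refl
count-Profile-single D D 1 0 1 refl = refl
count-Profile-single D D 1 0 (suc (suc r)) refl = refl

Profile-U∷ : ∀ y p q r z v →
  toℕ (Profile U y (suc p) q (suc r) (U ∷ z ∷ v))
    ≡ toℕ (Profile U y p q (suc r) (z ∷ v)) + toℕ (Profile D y p q r (z ∷ v))
Profile-U∷ y p q r U v = sym (+-identityʳ _)
Profile-U∷ y p q r D v = refl

Profile-U∷-noRuns : ∀ y p q z v → Profile U y (suc p) q 0 (U ∷ z ∷ v) ≡ false
Profile-U∷-noRuns y p q U v with upRuns (U ∷ v) | upRuns-pos {U ∷ v} refl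
... | suc _ | _ = x∧[y∧[z∧false]]≡false (endsWith y (U ∷ v)) (steps U (U ∷ v) ≡ᵇ p) (steps D (U ∷ v) ≡ᵇ q)
Profile-U∷-noRuns y p q D v =
  x∧[y∧[z∧false]]≡false (endsWith y (D ∷ v)) (steps U (D ∷ v) ≡ᵇ p) (steps D (D ∷ v) ≡ᵇ q)

Profile-D∷ : ∀ y p q r z v →
  toℕ (Profile D y p (suc q) r (D ∷ z ∷ v)) ≡ toℕ (Profile U y p q r (z ∷ v)) + toℕ (Profile D y p q r (z ∷ v))
Profile-D∷ y p q r U v = sym (+-identityʳ _)
Profile-D∷ y p q r D v = refl

profileCount-U∷ : ∀ y p q r → profileCount U y p q (suc r) + profileCount D y p q r ≡ profileCount U y (suc p) q (suc r)
profileCount-U∷ U p q r =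
  trans (sym (*-distribʳ-+ (compositions q r) (compositions p (suc r)) (compositions p r)))
        (cong (_* compositions q r) (+-comm (compositions p (suc r)) (compositions p r)))
profileCount-U∷ D p q r =
  trans (sym (*-distribʳ-+ (compositions q (suc r)) (compositions p (suc r)) (compositions p r)))
        (cong (_* compositions q (suc r)) (+-comm (compositions p (suc r)) (compositions p r)))

compositions-zero-zero : ∀ p q L → p + q ≡ suc L → compositions p 0 * compositions q 0 ≡ 0
compositions-zero-zero zero (suc q) L _ = refl
compositions-zero-zero (suc p) q L _ = refl

profileCount-D∷ : ∀ y p q r L → p + q ≡ suc L →
  profileCount U y p q r + profileCount D y p q r ≡ profileCount D y p (suc q) r
profileCount-D∷ U p q zero L p+q≡ = trans (compositions-zero-zero p q L p+q≡) (sym (*-zeroʳ (compositions p 0)))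
profileCount-D∷ U p q (suc r) L _ = sym (*-distribˡ-+ (compositions p (suc r)) (compositions q r) (compositions q (suc r)))
profileCount-D∷ D p q zero L p+q≡ =
  trans (cong (_+ compositions p 0 * compositions q 1) (sym (compositions-zero-zero p q L p+q≡)))
        (sym (*-distribˡ-+ (compositions p 0) (compositions q 0) (compositions q 1)))
profileCount-D∷ D p q (suc r) L _ =
  sym (*-distribˡ-+ (compositions p (suc r)) (compositions q (suc r)) (compositions q (suc (suc r))))

profileCount-noU : ∀ y q r → profileCount U y 0 q r ≡ 0
profileCount-noU U q zero = refl
profileCount-noU U q (suc r) = refl
profileCount-noU D q zero = refl
profileCount-noU D q (suc r) = refl

profileCount-noD : ∀ y p r → profileCount D y (suc p) 0 r ≡ 0
profileCount-noD U p zero = refl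
profileCount-noD U p (suc r) = *-zeroʳ (compositions (suc p) (suc r))
profileCount-noD D p r = *-zeroʳ (compositions (suc p) r)

profileCount-noRuns : ∀ y p q → profileCount U y p q 0 ≡ 0
profileCount-noRuns U p q = refl
profileCount-noRuns D p q = refl

count-Profile : ∀ L x y p q r → p + q ≡ suc L → count (Profile x y p q r) (words (suc L)) ≡ profileCount x y p q r
count-Profile zero x y p q r p+q≡1 = count-Profile-single x y p q r p+q≡1
count-Profile (suc L) U y p q r p+q≡ =
  trans (count-words-suc (Profile U y p q r) (suc L))
        (trans (cong (count (Profile U y p q r ∘ (U ∷_)) ws +_) (count-none _ ws (λ _ → refl)))
               (trans (+-identityʳ _) (startU p r p+q≡)))
  where
  ws = words (suc L)
  startU : ∀ p r → p + q ≡ suc (suc L) → count (Profile U y p q r ∘ (U ∷_)) ws ≡ profileCount U y p q r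
  startU zero r _ =
    trans (count-none _ ws (λ {w} _ → ∧-zeroʳ (endsWith y (U ∷ w)))) (sym (profileCount-noU y q r))
  startU (suc p) zero _ =
    trans (count-none _ ws (∈-words-suc-elim (λ w → Profile U y (suc p) q 0 (U ∷ w) ≡ false) (Profile-U∷-noRuns y p q) L))
          (sym (profileCount-noRuns y (suc p) q))
  startU (suc p) (suc r) p+q≡ =
    trans (count-split _ _ _ ws (∈-words-suc-elim Split (Profile-U∷ y p q r) L))
          (trans (cong₂ _+_ (count-Profile L U y p q (suc r) p+q≡′) (count-Profile L D y p q r p+q≡′))
                 (profileCount-U∷ y p q r))
    where
    Split = λ w → toℕ (Profile U y (suc p) q (suc r) (U ∷ w)) ≡ toℕ (Profile U y p q (suc r) w) + toℕ (Profile D y p q r w)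
    p+q≡′ = suc-injective p+q≡
count-Profile (suc L) D y p q r p+q≡ =
  trans (count-words-suc (Profile D y p q r) (suc L))
        (trans (cong (_+ count (Profile D y p q r ∘ (D ∷_)) ws) (count-none _ ws (λ _ → refl)))
               (startD q p+q≡))
  where
  ws = words (suc L)
  startD : ∀ q → p + q ≡ suc (suc L) → count (Profile D y p q r ∘ (D ∷_)) ws ≡ profileCount D y p q r
  startD zero p+0≡ =
    trans (count-none _ ws (λ {w} _ → trans (cong (endsWith y (D ∷ w) ∧_) (∧-zeroʳ _)) (∧-zeroʳ _)))
          (sym (subst (λ p → profileCount D y p 0 r ≡ 0) (sym (trans (sym (+-identityʳ p)) p+0≡))
                      (profileCount-noD y (suc L) r)))
  startD (suc q) p+q≡ =
    trans (count-split _ _ _ ws (∈-words-suc-elim Split (Profile-D∷ y p q r) L))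
          (trans (cong₂ _+_ (count-Profile L U y p q r p+q≡′) (count-Profile L D y p q r p+q≡′))
                 (profileCount-D∷ y p q r L p+q≡′))
    where
    Split = λ w → toℕ (Profile D y p (suc q) r (D ∷ w)) ≡ toℕ (Profile U y p q r w) + toℕ (Profile D y p q r w)
    p+q≡′ : p + q ≡ suc L
    p+q≡′ = suc-injective (trans (sym (+-suc p q)) p+q≡)

endsWithU+peaks≡upRuns : ∀ h w → toℕ (endsWith U w) + occFrom U D h w ≡ upRuns w
endsWithU+peaks≡upRuns h [] = refl
endsWithU+peaks≡upRuns h (U ∷ []) = refl
endsWithU+peaks≡upRuns h (D ∷ []) = refl
endsWithU+peaks≡upRuns h (U ∷ U ∷ w) = endsWithU+peaks≡upRuns (h ℤ.+ δ U) (U ∷ w)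
endsWithU+peaks≡upRuns h (U ∷ D ∷ w) =
  trans (+-suc (toℕ (endsWith U (D ∷ w))) _) (cong suc (endsWithU+peaks≡upRuns (h ℤ.+ δ U) (D ∷ w)))
endsWithU+peaks≡upRuns h (D ∷ U ∷ w) = endsWithU+peaks≡upRuns (h ℤ.+ δ D) (U ∷ w)
endsWithU+peaks≡upRuns h (D ∷ D ∷ w) = endsWithU+peaks≡upRuns (h ℤ.+ δ D) (D ∷ w)

doubleRises+upRuns≡ups : ∀ h w → occFrom U U h w + upRuns w ≡ steps U w
doubleRises+upRuns≡ups h [] = refl
doubleRises+upRuns≡ups h (U ∷ []) = refl
doubleRises+upRuns≡ups h (D ∷ []) = refl
doubleRises+upRuns≡ups h (U ∷ U ∷ w) = cong suc (doubleRises+upRuns≡ups (h ℤ.+ δ U) (U ∷ w))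
doubleRises+upRuns≡ups h (U ∷ D ∷ w) =
  trans (+-suc (occFrom U U (h ℤ.+ δ U) (D ∷ w)) (upRuns (D ∷ w))) (cong suc (doubleRises+upRuns≡ups (h ℤ.+ δ U) (D ∷ w)))
doubleRises+upRuns≡ups h (D ∷ U ∷ w) = doubleRises+upRuns≡ups (h ℤ.+ δ D) (U ∷ w)
doubleRises+upRuns≡ups h (D ∷ D ∷ w) = doubleRises+upRuns≡ups (h ℤ.+ δ D) (D ∷ w)

endsWithD≡not-endsWithU : ∀ x v → endsWith D (x ∷ v) ≡ not (endsWith U (x ∷ v))
endsWithD≡not-endsWithU U [] = refl
endsWithD≡not-endsWithU D [] = refl
endsWithD≡not-endsWithU x (y ∷ v) = endsWithD≡not-endsWithU y v

peaks-profile : ∀ p q k w →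
  ((steps U w ≡ᵇ p) ∧ (steps D w ≡ᵇ q)) ∧ ((occ U D w ≡ᵇ k) ∧ (startsWith D w ∧ endsWith U w))
    ≡ startsWith D w ∧ (endsWith U w ∧ ((steps U w ≡ᵇ p) ∧ ((steps D w ≡ᵇ q) ∧ (upRuns w ≡ᵇ suc k))))
peaks-profile p q k w with endsWith U w | endsWithU+peaks≡upRuns 0ℤ w
... | true | eq rewrite sym eq = ∧-shuffle (steps U w ≡ᵇ p) (steps D w ≡ᵇ q) (occ U D w ≡ᵇ k) (startsWith D w) true
... | false | _ = ∧-shuffle (steps U w ≡ᵇ p) (steps D w ≡ᵇ q) (occ U D w ≡ᵇ k) (startsWith D w) false

doubleRises-profile : ∀ p q t r w → t + r ≡ p →
  ((steps U w ≡ᵇ p) ∧ (steps D w ≡ᵇ q)) ∧ ((occ U U w ≡ᵇ t) ∧ (startsWith U w ∧ endsWith U w))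
    ≡ startsWith U w ∧ (endsWith U w ∧ ((steps U w ≡ᵇ p) ∧ ((steps D w ≡ᵇ q) ∧ (upRuns w ≡ᵇ r))))
doubleRises-profile p q t r w t+r≡p with steps U w ≡ᵇ p in #U≡p
... | false = ∧-shuffle false (steps D w ≡ᵇ q) (occ U U w ≡ᵇ t) (startsWith U w) (endsWith U w)
... | true = trans (∧-shuffle true (steps D w ≡ᵇ q) (occ U U w ≡ᵇ t) (startsWith U w) (endsWith U w))
                   (cong (λ b → startsWith U w ∧ (endsWith U w ∧ ((steps D w ≡ᵇ q) ∧ b)))
                         (≡ᵇ-cancel {occ U U w} {upRuns w} {t} {r} occ+upRuns≡t+r))
  where
  occ+upRuns≡t+r : occ U U w + upRuns w ≡ t + r
  occ+upRuns≡t+r = trans (doubleRises+upRuns≡ups 0ℤ w) (trans (≡ᵇ⇒≡ _ _ (subst T (sym #U≡p) tt)) (sym t+r≡p))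

peaks-startU-profile : ∀ p q k x v → let w = x ∷ v in
  toℕ (((steps U w ≡ᵇ p) ∧ (steps D w ≡ᵇ q)) ∧ ((occ U D w ≡ᵇ k) ∧ startsWith U w))
    ≡ toℕ (startsWith U w ∧ (endsWith U w ∧ ((steps U w ≡ᵇ p) ∧ ((steps D w ≡ᵇ q) ∧ (upRuns w ≡ᵇ suc k)))))
      + toℕ (startsWith U w ∧ (endsWith D w ∧ ((steps U w ≡ᵇ p) ∧ ((steps D w ≡ᵇ q) ∧ (upRuns w ≡ᵇ k)))))
peaks-startU-profile p q k x v
  with endsWith U (x ∷ v) | endsWithU+peaks≡upRuns 0ℤ (x ∷ v) | endsWithD≡not-endsWithU x v
... | true | eq | endsD rewrite endsD | sym eq =
  trans (cong toℕ (∧-shuffle′ (steps U w ≡ᵇ p) (steps D w ≡ᵇ q) (occ U D w ≡ᵇ k) (startsWith U w)))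
        (sym (trans (cong (toℕ (startsWith U w ∧ ((steps U w ≡ᵇ p) ∧ ((steps D w ≡ᵇ q) ∧ (occ U D w ≡ᵇ k)))) +_)
                          (cong toℕ (∧-zeroʳ (startsWith U w))))
                    (+-identityʳ _)))
  where w = x ∷ v
... | false | eq | endsD rewrite endsD | sym eq =
  trans (cong toℕ (∧-shuffle′ (steps U w ≡ᵇ p) (steps D w ≡ᵇ q) (occ U D w ≡ᵇ k) (startsWith U w)))
        (sym (cong (λ b → toℕ b + toℕ (startsWith U w ∧ ((steps U w ≡ᵇ p) ∧ ((steps D w ≡ᵇ q) ∧ (occ U D w ≡ᵇ k)))))
                   (∧-zeroʳ (startsWith U w))))
  where w = x ∷ v

steps-U+D : ∀ w → steps U w + steps D w ≡ length w
steps-U+D [] = refl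
steps-U+D (U ∷ w) = cong suc (steps-U+D w)
steps-U+D (D ∷ w) = trans (+-suc (steps U w) (steps D w)) (cong suc (steps-U+D w))

heightFrom-steps : ∀ h w → heightFrom h w ℤ.+ ℤ.+ steps D w ≡ h ℤ.+ ℤ.+ steps U w
heightFrom-steps h [] = refl
heightFrom-steps h (U ∷ w) = begin
  heightFrom (h ℤ.+ 1ℤ) w ℤ.+ ℤ.+ steps D w  ≡⟨ heightFrom-steps (h ℤ.+ 1ℤ) w ⟩
  h ℤ.+ 1ℤ ℤ.+ ℤ.+ steps U w                ≡⟨ ℤ.+-assoc h 1ℤ _ ⟩
  h ℤ.+ (1ℤ ℤ.+ ℤ.+ steps U w)              ≡⟨ cong (λ t → h ℤ.+ t) (ℤ.pos-+ 1 (steps U w)) ⟨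
  h ℤ.+ ℤ.+ (1 + steps U w)                 ∎
  where open ≡-Reasoning
heightFrom-steps h (D ∷ w) = begin
  H ℤ.+ ℤ.+ (1 + steps D w)          ≡⟨ cong (λ t → H ℤ.+ t) (ℤ.pos-+ 1 (steps D w)) ⟩
  H ℤ.+ (1ℤ ℤ.+ ℤ.+ steps D w)       ≡⟨ shuffle H (ℤ.+ steps D w) ⟩
  H ℤ.+ ℤ.+ steps D w ℤ.+ 1ℤ         ≡⟨ cong (ℤ._+ 1ℤ) (heightFrom-steps h′ w) ⟩
  h′ ℤ.+ ℤ.+ steps U w ℤ.+ 1ℤ        ≡⟨ cancel h (ℤ.+ steps U w) ⟩
  h ℤ.+ ℤ.+ steps U w                ∎
  where
  open ≡-Reasoning
  h′ = h ℤ.+ δ D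
  H = heightFrom h′ w
  shuffle : ∀ a d → a ℤ.+ (1ℤ ℤ.+ d) ≡ a ℤ.+ d ℤ.+ 1ℤ
  shuffle = solve-∀
  cancel : ∀ a u → a ℤ.+ ℤ.- 1ℤ ℤ.+ u ℤ.+ 1ℤ ≡ a ℤ.+ u
  cancel = solve-∀

inP-height : ∀ n w → T (inP n w) → heightFrom 0ℤ w ≡ 1ℤ
inP-height n w inPw =
  let _ , heights = T-∧⁻ {length w ≡ᵇ 2 * n + 1} inPw
      h≤1 , 1≤h = T-∧⁻ {heightFrom 0ℤ w ℤ.≤ᵇ 1ℤ} heights
  in ℤ.≤-antisym (ℤ.≤ᵇ⇒≤ h≤1) (ℤ.≤ᵇ⇒≤ 1≤h)

inP-rotate : ∀ n xs ys → inP n (ys ++ xs) ≡ inP n (xs ++ ys)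
inP-rotate n xs ys = cong₂ (λ l h → (l ≡ᵇ 2 * n + 1) ∧ ((h ℤ.≤ᵇ 1ℤ) ∧ (1ℤ ℤ.≤ᵇ h)))
  (trans (length-++ ys) (trans (+-comm (length ys) (length xs)) (sym (length-++ xs))))
  (heightFrom-rotate xs ys)

inP≡ : ∀ n w → length w ≡ 2 * n + 1 → inP n w ≡ ((steps U w ≡ᵇ suc n) ∧ (steps D w ≡ᵇ n))
inP≡ n w len rewrite T⇒≡true (≡⇒≡ᵇ (length w) (2 * n + 1) len) = T-ext to from
  where
  H = heightFrom 0ℤ w
  heights : H ℤ.+ ℤ.+ steps D w ≡ ℤ.+ steps U w
  heights = trans (heightFrom-steps 0ℤ w) (ℤ.+-identityˡ _)
  to : T ((H ℤ.≤ᵇ 1ℤ) ∧ (1ℤ ℤ.≤ᵇ H)) → T ((steps U w ≡ᵇ suc n) ∧ (steps D w ≡ᵇ n))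
  to t =
    let H≤1 , 1≤H = T-∧⁻ {H ℤ.≤ᵇ 1ℤ} t
        H≡1 = ℤ.≤-antisym (ℤ.≤ᵇ⇒≤ {H} {1ℤ} H≤1) (ℤ.≤ᵇ⇒≤ {1ℤ} {H} 1≤H)
        #U≡ : suc (steps D w) ≡ steps U w
        #U≡ = ℤ.+-injective (trans (ℤ.pos-+ 1 (steps D w)) (trans (cong (ℤ._+ ℤ.+ steps D w) (sym H≡1)) heights))
        #D≡ : steps D w ≡ n
        #D≡ = *-cancelˡ-≡ _ _ 2 (+-cancelʳ-≡ 1 _ _ (begin
                2 * steps D w + 1             ≡⟨ cong (_+ 1) (cong (steps D w +_) (+-identityʳ (steps D w))) ⟩
                steps D w + steps D w + 1     ≡⟨ +-comm (steps D w + steps D w) 1 ⟩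
                suc (steps D w + steps D w)   ≡⟨ cong (_+ steps D w) #U≡ ⟩
                steps U w + steps D w         ≡⟨ trans (steps-U+D w) len ⟩
                2 * n + 1                     ∎))
    in T-∧⁺ (≡⇒≡ᵇ _ _ (trans (sym #U≡) (cong suc #D≡))) (≡⇒≡ᵇ _ _ #D≡)
    where open ≡-Reasoning
  from : T ((steps U w ≡ᵇ suc n) ∧ (steps D w ≡ᵇ n)) → T ((H ℤ.≤ᵇ 1ℤ) ∧ (1ℤ ℤ.≤ᵇ H))
  from t =
    let #U≡ , #D≡ = T-∧⁻ {steps U w ≡ᵇ suc n} t
        H+n≡1+n : H ℤ.+ ℤ.+ n ≡ 1ℤ ℤ.+ ℤ.+ n
        H+n≡1+n = trans (cong (λ k → H ℤ.+ ℤ.+ k) (sym (≡ᵇ⇒≡ _ _ #D≡)))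
                        (trans heights (trans (cong ℤ.+_ (≡ᵇ⇒≡ _ _ #U≡)) (ℤ.pos-+ 1 n)))
        H≡1 = ℤ+-cancelʳ-≡ (ℤ.+ n) H 1ℤ H+n≡1+n
    in subst (λ h → T ((h ℤ.≤ᵇ 1ℤ) ∧ (1ℤ ℤ.≤ᵇ h))) (sym H≡1) tt

inP⇒ups : ∀ n {w} → length w ≡ 2 * n + 1 → T (inP n w) → steps U w ≡ suc n
inP⇒ups n {w} len inPw = ≡ᵇ⇒≡ _ _ (proj₁ (T-∧⁻ {steps U w ≡ᵇ suc n} (subst T (inP≡ n w len) inPw)))

inP⇒downs : ∀ n {w} → length w ≡ 2 * n + 1 → T (inP n w) → steps D w ≡ n
inP⇒downs n {w} len inPw = ≡ᵇ⇒≡ _ _ (proj₂ (T-∧⁻ {steps U w ≡ᵇ suc n} (subst T (inP≡ n w len) inPw)))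

opposite : Step → Step
opposite U = D
opposite D = U

reflect : List Step → List Step
reflect = map opposite

count-reflect : (P : List Step → Bool) → ∀ L → count P (words L) ≡ count (P ∘ reflect) (words L)
count-reflect P zero = refl
count-reflect P (suc L) = begin
  count P (words (suc L))                                                    ≡⟨ count-words-suc P L ⟩
  count (P ∘ (U ∷_)) (words L) + count (P ∘ (D ∷_)) (words L)
    ≡⟨ cong₂ _+_ (count-reflect _ L) (count-reflect _ L) ⟩
  count (P ∘ reflect ∘ (D ∷_)) (words L) + count (P ∘ reflect ∘ (U ∷_)) (words L)
    ≡⟨ +-comm (count (P ∘ reflect ∘ (D ∷_)) (words L)) _ ⟩
  count (P ∘ reflect ∘ (U ∷_)) (words L) + count (P ∘ reflect ∘ (D ∷_)) (words L)
    ≡⟨ count-words-suc (P ∘ reflect) L ⟨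
  count (P ∘ reflect) (words (suc L))                                        ∎
  where open ≡-Reasoning

opposite-== : ∀ x a → (opposite x == a) ≡ (x == opposite a)
opposite-== U U = refl
opposite-== U D = refl
opposite-== D U = refl
opposite-== D D = refl

steps-reflect : ∀ s w → steps s (reflect w) ≡ steps (opposite s) w
steps-reflect s [] = refl
steps-reflect s (x ∷ w) = cong₂ _+_ (cong toℕ (opposite-== x s)) (steps-reflect s w)

startsWith-reflect : ∀ s w → startsWith s (reflect w) ≡ startsWith (opposite s) w
startsWith-reflect s [] = refl
startsWith-reflect s (x ∷ w) = opposite-== x s

endsWith-reflect : ∀ s w → endsWith s (reflect w) ≡ endsWith (opposite s) w
endsWith-reflect s [] = refl
endsWith-reflect s (x ∷ []) = opposite-== x s
endsWith-reflect s (x ∷ y ∷ w) = endsWith-reflect s (y ∷ w)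

occFrom-reflect : ∀ a b h h′ w → occFrom a b h (reflect w) ≡ occFrom (opposite a) (opposite b) h′ w
occFrom-reflect a b h h′ [] = refl
occFrom-reflect a b h h′ (x ∷ []) = refl
occFrom-reflect a b h h′ (x ∷ y ∷ w) =
  cong₂ _+_ (cong₂ (λ s t → if s ∧ t then 1 else 0) (opposite-== x a) (opposite-== y b))
            (occFrom-reflect a b (h ℤ.+ δ (opposite x)) (h′ ℤ.+ δ x) (y ∷ w))

inP-reflect : ∀ n w → length w ≡ 2 * n + 1 → inP n (reflect w) ≡ ((steps U w ≡ᵇ n) ∧ (steps D w ≡ᵇ suc n))
inP-reflect n w len = begin
  inP n (reflect w)
    ≡⟨ inP≡ n (reflect w) (trans (length-map opposite w) len) ⟩
  (steps U (reflect w) ≡ᵇ suc n) ∧ (steps D (reflect w) ≡ᵇ n)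
    ≡⟨ cong₂ (λ u d → (u ≡ᵇ suc n) ∧ (d ≡ᵇ n)) (steps-reflect U w) (steps-reflect D w) ⟩
  (steps D w ≡ᵇ suc n) ∧ (steps U w ≡ᵇ n)                         ≡⟨ ∧-comm (steps D w ≡ᵇ suc n) _ ⟩
  (steps U w ≡ᵇ n) ∧ (steps D w ≡ᵇ suc n)                         ∎
  where open ≡-Reasoning

2n+1≡suc2n : ∀ n → 2 * n + 1 ≡ suc (2 * n)
2n+1≡suc2n n = +-comm (2 * n) 1

[1+n]+n≡2n+1 : ∀ n → suc n + n ≡ 2 * n + 1
[1+n]+n≡2n+1 n = trans (cong suc (cong (n +_) (sym (+-identityʳ n)))) (sym (2n+1≡suc2n n))

n+[1+n]≡2n+1 : ∀ n → n + suc n ≡ 2 * n + 1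
n+[1+n]≡2n+1 n = trans (+-comm n (suc n)) ([1+n]+n≡2n+1 n)

count-Profile-paths : ∀ n x y p q r → p + q ≡ 2 * n + 1 →
  count (Profile x y p q r) (words (2 * n + 1)) ≡ profileCount x y p q r
count-Profile-paths n x y p q r p+q≡ =
  trans (cong (count (Profile x y p q r) ∘ words) (2n+1≡suc2n n))
        (count-Profile (2 * n) x y p q r (trans p+q≡ (2n+1≡suc2n n)))

module _ (n k : ℕ) where

  private
    paths = words (2 * n + 1)

    inP-paths≡ : ∀ {w} → w ∈ paths → inP n w ≡ ((steps U w ≡ᵇ suc n) ∧ (steps D w ≡ᵇ n))
    inP-paths≡ {w} w∈ = inP≡ n w (words-length _ w∈)

    inP-reflect-paths≡ : ∀ {w} → w ∈ paths → inP n (reflect w) ≡ ((steps U w ≡ᵇ n) ∧ (steps D w ≡ᵇ suc n))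
    inP-reflect-paths≡ {w} w∈ = inP-reflect n w (words-length _ w∈)

    0≢2n+1 : 0 ≢ 2 * n + 1
    0≢2n+1 0≡ with () ← trans 0≡ (2n+1≡suc2n n)

  total-peaks : count (λ w → inP n w ∧ ((occ U D w ≡ᵇ k) ∧ (startsWith D w ∧ endsWith U w))) paths
                  ≡ profileCount D U (suc n) n (suc k)
  total-peaks =
    trans (count-cong _ _ paths (λ {w} w∈ →
             trans (cong (_∧ ((occ U D w ≡ᵇ k) ∧ (startsWith D w ∧ endsWith U w))) (inP-paths≡ w∈))
                   (peaks-profile (suc n) n k w)))
          (count-Profile-paths n D U (suc n) n (suc k) ([1+n]+n≡2n+1 n))

  total-valleys : count (λ w → inP n w ∧ ((occ D U w ≡ᵇ k) ∧ (startsWith U w ∧ endsWith D w))) paths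
                    ≡ profileCount D U n (suc n) (suc k)
  total-valleys =
    trans (count-reflect _ (2 * n + 1))
          (trans (count-cong _ _ paths reflected) (count-Profile-paths n D U n (suc n) (suc k) (n+[1+n]≡2n+1 n)))
    where
    reflected : ∀ {w} → w ∈ paths →
      inP n (reflect w) ∧ ((occ D U (reflect w) ≡ᵇ k) ∧ (startsWith U (reflect w) ∧ endsWith D (reflect w)))
        ≡ Profile D U n (suc n) (suc k) w
    reflected {w} w∈ rewrite inP-reflect-paths≡ w∈ | occFrom-reflect D U 0ℤ 0ℤ w | startsWith-reflect U w | endsWith-reflect D w =
      peaks-profile n (suc n) k w

  total-doubleRises : k ≤ n →
    count (λ w → inP n w ∧ ((occ U U w ≡ᵇ (n ∸ k)) ∧ (startsWith U w ∧ endsWith U w))) paths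
      ≡ profileCount U U (suc n) n (suc k)
  total-doubleRises k≤n =
    trans (count-cong _ _ paths (λ {w} w∈ →
             trans (cong (_∧ ((occ U U w ≡ᵇ (n ∸ k)) ∧ (startsWith U w ∧ endsWith U w))) (inP-paths≡ w∈))
                   (doubleRises-profile (suc n) n (n ∸ k) (suc k) w runs)))
          (count-Profile-paths n U U (suc n) n (suc k) ([1+n]+n≡2n+1 n))
    where
    runs : n ∸ k + suc k ≡ suc n
    runs = trans (+-suc (n ∸ k) k) (cong suc (m∸n+n≡m k≤n))

  total-doubleFalls : k < n →
    count (λ w → inP n w ∧ ((occ D D w ≡ᵇ (n ∸ k ∸ 1)) ∧ (startsWith D w ∧ endsWith D w))) paths
      ≡ profileCount U U n (suc n) (suc k)
  total-doubleFalls k<n =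
    trans (count-reflect _ (2 * n + 1))
          (trans (count-cong _ _ paths reflected) (count-Profile-paths n U U n (suc n) (suc k) (n+[1+n]≡2n+1 n)))
    where
    runs : n ∸ k ∸ 1 + suc k ≡ n
    runs = trans (+-suc (n ∸ k ∸ 1) k)
                 (trans (cong (_+ k) (trans (+-comm 1 _) (m∸n+n≡m (m<n⇒0<n∸m k<n)))) (m∸n+n≡m (<⇒≤ k<n)))
    reflected : ∀ {w} → w ∈ paths →
      inP n (reflect w) ∧ ((occ D D (reflect w) ≡ᵇ (n ∸ k ∸ 1)) ∧ (startsWith D (reflect w) ∧ endsWith D (reflect w)))
        ≡ Profile U U n (suc n) (suc k) w
    reflected {w} w∈ rewrite inP-reflect-paths≡ w∈ | occFrom-reflect D D 0ℤ 0ℤ w | startsWith-reflect D w | endsWith-reflect D w =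
      doubleRises-profile n (suc n) (n ∸ k ∸ 1) (suc k) w runs

  total-peaks-startU : count (λ w → inP n w ∧ ((occ U D w ≡ᵇ k) ∧ startsWith U w)) paths
                         ≡ profileCount U U (suc n) n (suc k) + profileCount U D (suc n) n k
  total-peaks-startU =
    trans (count-split _ _ _ paths pointwise)
          (cong₂ _+_ (count-Profile-paths n U U (suc n) n (suc k) ([1+n]+n≡2n+1 n))
                     (count-Profile-paths n U D (suc n) n k ([1+n]+n≡2n+1 n)))
    where
    pointwise : ∀ {w} → w ∈ paths → toℕ (inP n w ∧ ((occ U D w ≡ᵇ k) ∧ startsWith U w))
                  ≡ toℕ (Profile U U (suc n) n (suc k) w) + toℕ (Profile U D (suc n) n k w)
    pointwise {x ∷ v} w∈ rewrite inP-paths≡ w∈ = peaks-startU-profile (suc n) n k x v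
    pointwise {[]} w∈ = ⊥-elim (0≢2n+1 (words-length (2 * n + 1) w∈))

  total-valleys-startD : count (λ w → inP n w ∧ ((occ D U w ≡ᵇ k) ∧ startsWith D w)) paths
                           ≡ profileCount U U n (suc n) (suc k) + profileCount U D n (suc n) k
  total-valleys-startD =
    trans (count-reflect _ (2 * n + 1))
          (trans (count-split _ _ _ paths reflected)
                 (cong₂ _+_ (count-Profile-paths n U U n (suc n) (suc k) (n+[1+n]≡2n+1 n))
                            (count-Profile-paths n U D n (suc n) k (n+[1+n]≡2n+1 n))))
    where
    reflected : ∀ {w} → w ∈ paths → toℕ (inP n (reflect w) ∧ ((occ D U (reflect w) ≡ᵇ k) ∧ startsWith D (reflect w)))
                  ≡ toℕ (Profile U U n (suc n) (suc k) w) + toℕ (Profile U D n (suc n) k w)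
    reflected {x ∷ v} w∈ rewrite inP-reflect-paths≡ w∈ | occFrom-reflect D U 0ℤ 0ℤ (x ∷ v) | startsWith-reflect D (x ∷ v) =
      peaks-startU-profile n (suc n) k x v
    reflected {[]} w∈ = ⊥-elim (0≢2n+1 (words-length (2 * n + 1) w∈))

-- Uniform distribution of the statistics

factor : Step → Step → Step → Step → Bool
factor a b x y = (x == a) ∧ (y == b)

before : Step → Step → Step → Bool
before a x y = y == a

module _ (a b : Step) where

  open Junctions (factor a b)

  occFrom≡length-junctions : ∀ i h w → occFrom a b h w ≡ length (junctionsFrom i h w)
  occFrom≡length-junctions i h [] = refl
  occFrom≡length-junctions i h (x ∷ []) = refl
  occFrom≡length-junctions i h (x ∷ y ∷ w) =
    sym (trans (length-consIf (factor a b x y) _ _)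
               (cong (toℕ (factor a b x y) +_) (sym (occFrom≡length-junctions (suc i) (h ℤ.+ δ x) (y ∷ w)))))

  occBelowFrom≡count-junctions : ∀ i h w → occBelowFrom a b h w ≡ count below (junctionsFrom i h w)
  occBelowFrom≡count-junctions i h [] = refl
  occBelowFrom≡count-junctions i h (x ∷ []) = refl
  occBelowFrom≡count-junctions i h (x ∷ y ∷ w) =
    sym (trans (count-consIf below (factor a b x y) _ _)
               (cong₂ _+_ (cong toℕ (∧-assoc (x == a) (y == b) _))
                          (sym (occBelowFrom≡count-junctions (suc i) (h ℤ.+ δ x) (y ∷ w)))))

  occ-rotate : ∀ x xs y ys → factor a b (lastStep x xs) y ≡ factor a b (lastStep y ys) x →
    occ a b ((y ∷ ys) ++ (x ∷ xs)) ≡ occ a b ((x ∷ xs) ++ (y ∷ ys))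
  occ-rotate x xs y ys same =
    trans (occFrom≡length-junctions 0 0ℤ ((y ∷ ys) ++ (x ∷ xs)))
          (trans (length-junctions-rotate x xs y ys same) (sym (occFrom≡length-junctions 0 0ℤ ((x ∷ xs) ++ (y ∷ ys)))))

stepsBelowFrom≡count-junctions : ∀ a i h x w →
  stepsBelowFrom a h (x ∷ w) ≡ toℕ ((x == a) ∧ (h ℤ.≤ᵇ 0ℤ)) + count below (Junctions.junctionsFrom (before a) i h (x ∷ w))
stepsBelowFrom≡count-junctions a i h x [] = refl
stepsBelowFrom≡count-junctions a i h x (y ∷ w) =
  cong (toℕ ((x == a) ∧ (h ℤ.≤ᵇ 0ℤ)) +_)
       (trans (stepsBelowFrom≡count-junctions a (suc i) (h ℤ.+ δ x) y w) (sym (count-consIf below (y == a) _ _)))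

length-junctions-before : ∀ a i h x w → length (Junctions.junctionsFrom (before a) i h (x ∷ w)) ≡ steps a w
length-junctions-before a i h x [] = refl
length-junctions-before a i h x (y ∷ w) =
  trans (length-consIf (y == a) _ _) (cong (toℕ (y == a) +_) (length-junctions-before a (suc i) (h ℤ.+ δ x) y w))

occBelow-uniform : ∀ a b n t {j} → j ≤ t →
  suc t * count (λ w → inP n w ∧ ((occ a b w ≡ᵇ t) ∧ (startsWith b w ∧ (endsWith a w ∧ (occBelow a b w ≡ᵇ j)))))
                (words (2 * n + 1))
    ≡ count (λ w → inP n w ∧ ((occ a b w ≡ᵇ t) ∧ (startsWith b w ∧ endsWith a w))) (words (2 * n + 1))
occBelow-uniform a b n t {j} j≤t =
  trans (cong (suc t *_) (count-cong _ _ (words (2 * n + 1)) (λ {w} _ → occBelow≡belowCount w))) (uniform j≤t)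
  where
  open Rotation (factor a b)

  W : List Step → Bool
  W w = inP n w ∧ ((occ a b w ≡ᵇ t) ∧ (startsWith b w ∧ endsWith a w))

  W⁻ : ∀ w → T (W w) → T (inP n w) × T (occ a b w ≡ᵇ t) × T (startsWith b w) × T (endsWith a w)
  W⁻ w Ww = let inPw , rest = T-∧⁻ {inP n w} Ww
                occ≡t , ends = T-∧⁻ {occ a b w ≡ᵇ t} rest
            in inPw , occ≡t , T-∧⁻ {startsWith b w} ends

  W-closes : ∀ {w} → T (W w) → T (closes w)
  W-closes {[]} Ww = proj₁ (proj₂ (proj₂ (W⁻ [] Ww)))
  W-closes {x ∷ v} Ww = let _ , _ , starts , ends = W⁻ (x ∷ v) Ww in T-∧⁺ (subst T (endsWith-lastStep a x v) ends) starts

  W-height : ∀ {w} → T (W w) → heightFrom 0ℤ w ≡ 1ℤ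
  W-height {w} Ww = inP-height n w (proj₁ (W⁻ w Ww))

  W-junctions : ∀ {w} → length w ≡ 2 * n + 1 → T (W w) → length (junctions w) ≡ t
  W-junctions {w} _ Ww = trans (sym (occFrom≡length-junctions a b 0 0ℤ w)) (≡ᵇ⇒≡ _ _ (proj₁ (proj₂ (W⁻ w Ww))))

  W-rotate : ∀ x xs y ys → T (factor a b (lastStep x xs) y) → T (W ((x ∷ xs) ++ (y ∷ ys))) → T (W ((y ∷ ys) ++ (x ∷ xs)))
  W-rotate x xs y ys Jxy Ww =
    let inPw , occ≡t , x≡b , ends = W⁻ ((x ∷ xs) ++ (y ∷ ys)) Ww
        last≡a , y≡b = T-∧⁻ {lastStep x xs == a} Jxy
        lastY≡a : T (lastStep y ys == a)
        lastY≡a = subst T (trans (endsWith-lastStep a x (xs ++ y ∷ ys)) (cong (_== a) (lastStep-++ x xs y ys))) ends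
        lastX≡a : T (endsWith a ((y ∷ ys) ++ (x ∷ xs)))
        lastX≡a = subst T (sym (trans (endsWith-lastStep a y (ys ++ x ∷ xs)) (cong (_== a) (lastStep-++ y ys x xs)))) last≡a
        same = trans (T⇒≡true Jxy) (sym (T⇒≡true (T-∧⁺ {lastStep y ys == a} lastY≡a x≡b)))
    in T-∧⁺ (subst T (sym (inP-rotate n (x ∷ xs) (y ∷ ys))) inPw)
            (T-∧⁺ (subst (λ o → T (o ≡ᵇ t)) (sym (occ-rotate a b x xs y ys same)) occ≡t) (T-∧⁺ y≡b lastX≡a))

  open Uniform W (2 * n + 1) t (λ {w} → W-closes {w}) (λ {w} → W-height {w}) (λ {w} → W-junctions {w}) W-rotate

  occBelow≡belowCount : ∀ w → inP n w ∧ ((occ a b w ≡ᵇ t) ∧ (startsWith b w ∧ (endsWith a w ∧ (occBelow a b w ≡ᵇ j))))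
                              ≡ Wj j w
  occBelow≡belowCount w =
    trans (cong (λ r → inP n w ∧ ((occ a b w ≡ᵇ t) ∧ r)) (sym (∧-assoc (startsWith b w) (endsWith a w) _)))
          (∧-reassoc (inP n w) (occ a b w ≡ᵇ t) (startsWith b w ∧ endsWith a w)
                     (λ _ → cong (_≡ᵇ j) (occBelowFrom≡count-junctions a b 0 0ℤ w)))

==-opposite : ∀ a → (a == opposite a) ≡ false
==-opposite U = refl
==-opposite D = refl

factor-opposite-into : ∀ a s z → T (z == a) → factor a (opposite a) s z ≡ false
factor-opposite-into a s z z≡a rewrite ==⇒≡ {z} {a} z≡a | ==-opposite a = ∧-zeroʳ (s == a)

stepsBelow-uniform : ∀ a n k m → (∀ {w} → length w ≡ 2 * n + 1 → T (inP n w) → steps a w ≡ suc m) → ∀ {j} → j ≤ m →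
  suc m * count (λ w → inP n w ∧ ((occ a (opposite a) w ≡ᵇ k) ∧ (startsWith a w ∧ (stepsBelow a w ≡ᵇ suc j))))
                (words (2 * n + 1))
    ≡ count (λ w → inP n w ∧ ((occ a (opposite a) w ≡ᵇ k) ∧ startsWith a w)) (words (2 * n + 1))
stepsBelow-uniform a n k m #a≡ {j} j≤m =
  trans (cong (suc m *_) (count-cong _ _ (words (2 * n + 1)) (λ {w} _ → stepsBelow≡belowCount w))) (uniform j≤m)
  where
  open Rotation (before a)

  W : List Step → Bool
  W w = inP n w ∧ ((occ a (opposite a) w ≡ᵇ k) ∧ startsWith a w)

  W⁻ : ∀ w → T (W w) → T (inP n w) × T (occ a (opposite a) w ≡ᵇ k) × T (startsWith a w)
  W⁻ w Ww = let inPw , rest = T-∧⁻ {inP n w} Ww in inPw , T-∧⁻ {occ a (opposite a) w ≡ᵇ k} rest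

  W-closes : ∀ {w} → T (W w) → T (closes w)
  W-closes {[]} Ww = proj₂ (proj₂ (W⁻ [] Ww))
  W-closes {x ∷ v} Ww = proj₂ (proj₂ (W⁻ (x ∷ v) Ww))

  W-height : ∀ {w} → T (W w) → heightFrom 0ℤ w ≡ 1ℤ
  W-height {w} Ww = inP-height n w (proj₁ (W⁻ w Ww))

  W-junctions : ∀ {w} → length w ≡ 2 * n + 1 → T (W w) → length (junctions w) ≡ m
  W-junctions {[]} _ Ww = ⊥-elim (proj₂ (proj₂ (W⁻ [] Ww)))
  W-junctions {x ∷ v} len Ww =
    let inPw , _ , x≡a = W⁻ (x ∷ v) Ww
    in trans (length-junctions-before a 0 0ℤ x v)
             (suc-injective (trans (cong (λ b → toℕ b + steps a v) (sym (T⇒≡true {x == a} x≡a)))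
                                   (#a≡ {x ∷ v} len inPw)))

  W-rotate : ∀ x xs y ys → T (before a (lastStep x xs) y) → T (W ((x ∷ xs) ++ (y ∷ ys))) → T (W ((y ∷ ys) ++ (x ∷ xs)))
  W-rotate x xs y ys y≡a Ww =
    let inPw , occ≡k , x≡a = W⁻ ((x ∷ xs) ++ (y ∷ ys)) Ww
        same = trans (factor-opposite-into a (lastStep x xs) y y≡a) (sym (factor-opposite-into a (lastStep y ys) x x≡a))
    in T-∧⁺ (subst T (sym (inP-rotate n (x ∷ xs) (y ∷ ys))) inPw)
            (T-∧⁺ (subst (λ o → T (o ≡ᵇ k)) (sym (occ-rotate a (opposite a) x xs y ys same)) occ≡k) y≡a)

  open Uniform W (2 * n + 1) m (λ {w} → W-closes {w}) (λ {w} → W-height {w}) (λ {w} → W-junctions {w}) W-rotate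

  -- The first step starts at height 0, so it is always counted.
  stepsBelow≡belowCount : ∀ w → inP n w ∧ ((occ a (opposite a) w ≡ᵇ k) ∧ (startsWith a w ∧ (stepsBelow a w ≡ᵇ suc j)))
                                ≡ Wj j w
  stepsBelow≡belowCount [] = ∧-reassoc (inP n []) (occ a (opposite a) [] ≡ᵇ k) false {stepsBelow a [] ≡ᵇ suc j} λ ()
  stepsBelow≡belowCount (x ∷ v) = ∧-reassoc (inP n (x ∷ v)) (occ a (opposite a) (x ∷ v) ≡ᵇ k) (x == a)
    λ x≡a → cong (_≡ᵇ suc j) (trans (stepsBelowFrom≡count-junctions a 0 0ℤ x v)
                                     (cong (λ b → toℕ (b ∧ true) + belowCount (x ∷ v)) x≡a))

countP≡count : ∀ n p → countP n p ≡ count (λ w → inP n w ∧ p w) (words (2 * n + 1))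
countP≡count n p = length-filterᵇ (λ w → inP n w ∧ p w) (words (2 * n + 1))

peaks-uniform : ∀ n k j → j < suc k →
  suc k * countP (suc n) (λ w → (occ U D w ≡ᵇ k) ∧ startsWith D w ∧ endsWith U w ∧ (occBelow U D w ≡ᵇ j))
    ≡ (suc n C k) * (n C k)
peaks-uniform n k j j<1+k = begin
  suc k * countP (suc n) _                        ≡⟨ cong (suc k *_) (countP≡count (suc n) _) ⟩
  suc k * count _ (words (2 * suc n + 1))         ≡⟨ occBelow-uniform U D (suc n) k (s≤s⁻¹ j<1+k) ⟩
  count _ (words (2 * suc n + 1))                 ≡⟨ total-peaks (suc n) k ⟩
  compositions (suc (suc n)) (suc k) * compositions (suc n) (suc k)
                                                  ≡⟨ cong₂ _*_ (compositions-suc-suc (suc n) k) (compositions-suc-suc n k) ⟩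
  (suc n C k) * (n C k)                           ∎
  where open ≡-Reasoning

valleys-uniform : ∀ n k j → j < suc k →
  suc k * countP (suc n) (λ w → (occ D U w ≡ᵇ k) ∧ startsWith U w ∧ endsWith D w ∧ (occBelow D U w ≡ᵇ j))
    ≡ (suc n C k) * (n C k)
valleys-uniform n k j j<1+k = begin
  suc k * countP (suc n) _                        ≡⟨ cong (suc k *_) (countP≡count (suc n) _) ⟩
  suc k * count _ (words (2 * suc n + 1))         ≡⟨ occBelow-uniform D U (suc n) k (s≤s⁻¹ j<1+k) ⟩
  count _ (words (2 * suc n + 1))                 ≡⟨ total-valleys (suc n) k ⟩
  compositions (suc n) (suc k) * compositions (suc (suc n)) (suc k)
                                                  ≡⟨ cong₂ _*_ (compositions-suc-suc n k) (compositions-suc-suc (suc n) k) ⟩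
  (n C k) * (suc n C k)                           ≡⟨ *-comm (n C k) _ ⟩
  (suc n C k) * (n C k)                           ∎
  where open ≡-Reasoning

doubleRises-uniform : ∀ n k j → j + suc k ≤ suc n →
  (suc n ∸ suc k + 1) * countP (suc n) (λ w → (occ U U w ≡ᵇ (suc n ∸ suc k)) ∧ startsWith U w ∧ endsWith U w ∧ (occBelow U U w ≡ᵇ j))
    ≡ (suc n C suc k) * (n C k)
doubleRises-uniform n k j j+k<n = begin
  (n ∸ k + 1) * countP (suc n) _                  ≡⟨ cong₂ _*_ (+-comm (n ∸ k) 1) (countP≡count (suc n) _) ⟩
  suc (n ∸ k) * count _ (words (2 * suc n + 1))   ≡⟨ occBelow-uniform U U (suc n) (n ∸ k) j≤n∸k ⟩
  count _ (words (2 * suc n + 1))                 ≡⟨ total-doubleRises (suc n) (suc k) (s≤s k≤n) ⟩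
  compositions (suc (suc n)) (suc (suc k)) * compositions (suc n) (suc k)
                                                  ≡⟨ cong₂ _*_ (compositions-suc-suc (suc n) (suc k)) (compositions-suc-suc n k) ⟩
  (suc n C suc k) * (n C k)                       ∎
  where
  open ≡-Reasoning
  k≤n : k ≤ n
  k≤n = s≤s⁻¹ (≤-trans (m≤n+m (suc k) j) j+k<n)
  j≤n∸k : j ≤ n ∸ k
  j≤n∸k = subst (_≤ n ∸ k) (m+n∸n≡m j k) (∸-monoˡ-≤ k (s≤s⁻¹ (subst (_≤ suc n) (+-suc j k) j+k<n)))

doubleFalls-uniform : ∀ n k → suc k < suc n → ∀ j → j + suc k + 1 ≤ suc n →
  (suc n ∸ suc k) * countP (suc n) (λ w → (occ D D w ≡ᵇ (suc n ∸ suc k ∸ 1)) ∧ startsWith D w ∧ endsWith D w ∧ (occBelow D D w ≡ᵇ j))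
    ≡ (suc n C k) * (n C suc k)
doubleFalls-uniform n k k<n j j+k+1≤n = begin
  (n ∸ k) * countP (suc n) _                      ≡⟨ cong₂ _*_ n∸k≡ (countP≡count (suc n) _) ⟩
  suc (n ∸ k ∸ 1) * count _ (words (2 * suc n + 1))
                                                  ≡⟨ occBelow-uniform D D (suc n) (n ∸ k ∸ 1) j≤ ⟩
  count _ (words (2 * suc n + 1))                 ≡⟨ total-doubleFalls (suc n) (suc k) k<n ⟩
  compositions (suc n) (suc (suc k)) * compositions (suc (suc n)) (suc k)
                                                  ≡⟨ cong₂ _*_ (compositions-suc-suc n (suc k)) (compositions-suc-suc (suc n) k) ⟩
  (n C suc k) * (suc n C k)                       ≡⟨ *-comm (n C suc k) _ ⟩
  (suc n C k) * (n C suc k)                       ∎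
  where
  open ≡-Reasoning
  n∸k≡ : n ∸ k ≡ suc (n ∸ k ∸ 1)
  n∸k≡ = sym (m+[n∸m]≡n {1} {n ∸ k} (m<n⇒0<n∸m (s≤s⁻¹ k<n)))
  j≤ : j ≤ n ∸ k ∸ 1
  j≤ = subst (_≤ n ∸ k ∸ 1) (trans (cong (_∸ 1) (m+n∸n≡m (j + 1) k)) (m+n∸n≡m j 1))
             (∸-monoˡ-≤ 1 (∸-monoˡ-≤ k (s≤s⁻¹ (subst (_≤ suc n) (reorder j k) j+k+1≤n))))
    where
    reorder : ∀ j k → j + suc k + 1 ≡ suc (j + 1 + k)
    reorder = ℕ-solve-∀

upSteps-uniform : ∀ n k j → j ≤ suc n →
  (suc n + 1) * countP (suc n) (λ w → (occ U D w ≡ᵇ suc k) ∧ startsWith U w ∧ (stepsBelow U w ≡ᵇ suc j))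
    ≡ ((suc n + 1) C suc k) * (n C k)
upSteps-uniform n k j j≤1+n = begin
  (suc n + 1) * countP (suc n) _                    ≡⟨ cong₂ _*_ (+-comm (suc n) 1) (countP≡count (suc n) _) ⟩
  suc (suc n) * count _ (words (2 * suc n + 1))
    ≡⟨ stepsBelow-uniform U (suc n) (suc k) (suc n) (λ {w} → inP⇒ups (suc n) {w}) j≤1+n ⟩
  count _ (words (2 * suc n + 1))                   ≡⟨ total-peaks-startU (suc n) (suc k) ⟩
  compositions (suc (suc n)) (suc (suc k)) * compositions (suc n) (suc k)
    + compositions (suc (suc n)) (suc k) * compositions (suc n) (suc k)
      ≡⟨ cong₂ _+_ (cong₂ _*_ (compositions-suc-suc (suc n) (suc k)) (compositions-suc-suc n k))
                   (cong₂ _*_ (compositions-suc-suc (suc n) k) (compositions-suc-suc n k)) ⟩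
  (suc n C suc k) * (n C k) + (suc n C k) * (n C k) ≡⟨ *-distribʳ-+ (n C k) (suc n C suc k) _ ⟨
  (suc n C suc k + suc n C k) * (n C k)
    ≡⟨ cong (_* (n C k)) (trans (+-comm (suc n C suc k) _) (nCk+nC[k+1]≡[n+1]C[k+1] (suc n) k)) ⟩
  (suc (suc n) C suc k) * (n C k)                   ≡⟨ cong (λ m → (m C suc k) * (n C k)) (+-comm 1 (suc n)) ⟩
  ((suc n + 1) C suc k) * (n C k)                   ∎
  where open ≡-Reasoning

downSteps-uniform : ∀ n k j → j ≤ n →
  suc n * countP (suc n) (λ w → (occ D U w ≡ᵇ suc k) ∧ startsWith D w ∧ (stepsBelow D w ≡ᵇ suc j))
    ≡ (suc n C suc k) * (suc n C k)
downSteps-uniform n k j j≤n = begin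
  suc n * countP (suc n) _                          ≡⟨ cong (suc n *_) (countP≡count (suc n) _) ⟩
  suc n * count _ (words (2 * suc n + 1))
    ≡⟨ stepsBelow-uniform D (suc n) (suc k) n (λ {w} → inP⇒downs (suc n) {w}) j≤n ⟩
  count _ (words (2 * suc n + 1))                   ≡⟨ total-valleys-startD (suc n) (suc k) ⟩
  compositions (suc n) (suc (suc k)) * compositions (suc (suc n)) (suc k)
    + compositions (suc n) (suc k) * compositions (suc (suc n)) (suc k)
      ≡⟨ cong₂ _+_ (cong₂ _*_ (compositions-suc-suc n (suc k)) (compositions-suc-suc (suc n) k))
                   (cong₂ _*_ (compositions-suc-suc n k) (compositions-suc-suc (suc n) k)) ⟩
  (n C suc k) * (suc n C k) + (n C k) * (suc n C k) ≡⟨ *-distribʳ-+ (suc n C k) (n C suc k) _ ⟨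
  (n C suc k + n C k) * (suc n C k)
    ≡⟨ cong (_* (suc n C k)) (trans (+-comm (n C suc k) _) (nCk+nC[k+1]≡[n+1]C[k+1] n k)) ⟩
  (suc n C suc k) * (suc n C k)                     ∎
  where open ≡-Reasoning

theorem6 : (n k : ℕ) → 1 ≤ n → 1 ≤ k →
    ((j : ℕ) → j < k →
      k * countP n (λ w → (occ U D w ≡ᵇ (k ∸ 1)) ∧ startsWith D w ∧ endsWith U w ∧ (occBelow U D w ≡ᵇ j))
        ≡ (n C (k ∸ 1)) * ((n ∸ 1) C (k ∸ 1)))
    × ((j : ℕ) → j < k →
      k * countP n (λ w → (occ D U w ≡ᵇ (k ∸ 1)) ∧ startsWith U w ∧ endsWith D w ∧ (occBelow D U w ≡ᵇ j))
        ≡ (n C (k ∸ 1)) * ((n ∸ 1) C (k ∸ 1)))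
    × ((j : ℕ) → j + k ≤ n →
      (n ∸ k + 1) * countP n (λ w → (occ U U w ≡ᵇ (n ∸ k)) ∧ startsWith U w ∧ endsWith U w ∧ (occBelow U U w ≡ᵇ j))
        ≡ (n C k) * ((n ∸ 1) C (k ∸ 1)))
    × (k < n → (j : ℕ) → j + k + 1 ≤ n →
      (n ∸ k) * countP n (λ w → (occ D D w ≡ᵇ (n ∸ k ∸ 1)) ∧ startsWith D w ∧ endsWith D w ∧ (occBelow D D w ≡ᵇ j))
        ≡ (n C (k ∸ 1)) * ((n ∸ 1) C k))
    × ((j : ℕ) → 1 ≤ j → j ≤ n + 1 →
      (n + 1) * countP n (λ w → (occ U D w ≡ᵇ k) ∧ startsWith U w ∧ (stepsBelow U w ≡ᵇ j))
        ≡ ((n + 1) C k) * ((n ∸ 1) C (k ∸ 1)))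
    × ((j : ℕ) → 1 ≤ j → j ≤ n →
      n * countP n (λ w → (occ D U w ≡ᵇ k) ∧ startsWith D w ∧ (stepsBelow D w ≡ᵇ j))
        ≡ (n C k) * (n C (k ∸ 1)))
theorem6 (suc n) (suc k) _ _ =
    peaks-uniform n k
  , valleys-uniform n k
  , doubleRises-uniform n k
  , doubleFalls-uniform n k
  , (λ { (suc j) _ j≤n+1 → upSteps-uniform n k j (s≤s⁻¹ (subst (suc j ≤_) (+-comm (suc n) 1) j≤n+1)) })
  , (λ { (suc j) _ j≤n → downSteps-uniform n k j (s≤s⁻¹ j≤n) })
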